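{- Let $\mathcal{P}$ be the uniform distribution on $\{(x_1,x_2,x_3)\in(\mathbb{F}_2^n)^3 : x_1+x_2+x_3=0\}$. Let $E=E_1\times E_2\times E_3\subseteq(\mathbb{F}_2^n)^3$ with $E_i\subseteq\mathbb{F}_2^n$ and $\mathcal{P}(E)=\alpha$. Then for every $\delta>0$ there exists an affine partition $\Pi$ of $(\mathbb{F}_2^n)^3$ of codimension at most $3/\delta^3$ such that the following holds: with probability at least $1-\delta/\alpha$ over $\pi\sim\Pi(\mathcal{P}|E)$, writing $\pi=\pi_1\times\pi_2\times\pi_3$ where $\pi_1,\pi_2,\pi_3$ are affine shifts of a subspace $\mathcal{V}\subseteq\mathbb{F}_2^n$, we have $\big|\widehat{E_i|_{\pi_i}}(\chi)\big|\le\delta$ for all $i\in[3]$ and all non-zero characters $\chi\in\widehat{\mathcal{V}}$.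
   Context: An affine partition of $(\mathbb{F}_2^n)^3$ of codimension at most $d$ is a partition $\Pi$ of $(\mathbb{F}_2^n)^3$ such that every part $\pi\in\Pi$ has the form $a_\pi+\mathcal{V}_\pi^3$ for some $a_\pi\in(\mathbb{F}_2^n)^3$ and some linear subspace $\mathcal{V}_\pi\subseteq\mathbb{F}_2^n$ of codimension at most $d$. $\Pi(\mathcal{P}|E)$ denotes the distribution on parts obtained by sampling $x$ from $\mathcal{P}$ conditioned on $E$ and outputting the part of $\Pi$ containing $x$. For a subspace $\mathcal{V}$, its characters are the homomorphisms $\chi:\mathcal{V}\to\{ -1,1\}$ (the non-zero ones being those not identically $1$). For an affine shift $U=a+\mathcal{V}$ and $S\subseteq\mathbb{F}_2^n$, $S|_U:U\to\{0,1\}$ is the indicator of $S\cap U$, and its Fourier coefficient at $\chi$ is $\widehat{S|_U}(\chi)=\mathbb{E}_{x\sim U}[S|_U(x)\chi(x+a)]$ (uniform $x$ in $U$); its absolute value does not depend on the choice of $a\in U$.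
   Formalization: The parameter δ ranges over the positive rationals. -}

module Defs where

open import Data.Bool using (Bool; true; false; _xor_; _∧_; if_then_else_)
open import Data.Nat as ℕ using (ℕ; zero; suc; _∸_)
open import Data.Integer as ℤ using (ℤ; +_)
open import Data.Rational as ℚ using (ℚ; 0ℚ; 1ℚ; _÷_)
open import Data.Rational.Properties using (_≟_)
open import Data.Fin using (Fin) renaming (zero to fz; suc to fs)
open import Data.Vec using (Vec; []; _∷_; replicate; zipWith)
open import Data.List using (List; []; _∷_; map; concatMap; filter; length; foldr)
open import Data.Product using (_×_; _,_; Σ; ∃; proj₁; proj₂)
open import Data.Vec.Relation.Unary.All using (All)
open import Relation.Binary.PropositionalEquality using (_≡_; _≢_)
open import Relation.Nullary using (yes; no)
open import Function using (_⇔_)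

F2^ : ℕ → Set
F2^ n = Vec Bool n

0v : ∀ {n} → F2^ n
0v {n} = replicate n false

infixl 6 _⊕_
_⊕_ : ∀ {n} → F2^ n → F2^ n → F2^ n
_⊕_ = zipWith _xor_

allVecs : (n : ℕ) → List (F2^ n)
allVecs zero    = [] ∷ []
allVecs (suc n) = concatMap (λ v → (false ∷ v) ∷ (true ∷ v) ∷ []) (allVecs n)

Triple : ℕ → Set
Triple n = F2^ n × F2^ n × F2^ n

allTriples : (n : ℕ) → List (Triple n)
allTriples n = concatMap (λ x → concatMap (λ y → map (λ z → x , y , z) (allVecs n)) (allVecs n)) (allVecs n)

count : ∀ {A : Set} → (A → Bool) → List A → ℕ
count p xs = length (filter (λ x → Data.Bool._≟_ (p x) true) xs)
  where import Data.Bool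

-- Total rational division (the denominator is always nonzero where used).

_/?_ : ℚ → ℚ → ℚ
p /? q with q ≟ 0ℚ
... | yes _  = 0ℚ
... | no q≢0 = _÷_ p q {{ℚ.≢-nonZero q≢0}}

ℕ→ℚ : ℕ → ℚ
ℕ→ℚ k = ℚ._/_ (+ k) 1

ℤ→ℚ : ℤ → ℚ
ℤ→ℚ z = ℚ._/_ z 1

-- Linear subspaces of F₂ⁿ (decidable membership; contains 0, closed
-- under addition, which over F₂ is exactly being a linear subspace).

record Subspace (n : ℕ) : Set where
  field
    mem    : F2^ n → Bool
    zero∈  : mem 0v ≡ true
    closed : ∀ x y → mem x ≡ true → mem y ≡ true → mem (x ⊕ y) ≡ true
open Subspace public

lincomb : ∀ {n k} → Vec Bool k → Vec (F2^ n) k → F2^ n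
lincomb []       []       = 0v
lincomb (c ∷ cs) (b ∷ bs) = if c then b ⊕ lincomb cs bs else lincomb cs bs

IsBasis : ∀ {n k} → Subspace n → Vec (F2^ n) k → Set
IsBasis {n} {k} V B =
  All (λ b → mem V b ≡ true) B
  × (∀ (c : Vec Bool k) → lincomb c B ≡ 0v → c ≡ replicate k false)
  × (∀ v → mem V v ≡ true → ∃ λ (c : Vec Bool k) → lincomb c B ≡ v)

HasDim : ∀ {n} → Subspace n → ℕ → Set
HasDim {n} V k = Σ (Vec (F2^ n) k) (IsBasis V)

CodimAtMost : ∀ {n} → Subspace n → ℕ → Set
CodimAtMost {n} V d = ∃ λ k → HasDim V k × (n ∸ k) ℕ.≤ d

record AffPart (n : ℕ) : Set where
  constructor affPart
  field
    shift : Triple n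
    sub   : Subspace n
open AffPart public

coord : ∀ {n} → Fin 3 → Triple n → F2^ n
coord fz           (x , y , z) = x
coord (fs fz)      (x , y , z) = y
coord (fs (fs _))  (x , y , z) = z

inPart : ∀ {n} → AffPart n → Triple n → Bool
inPart (affPart (a₁ , a₂ , a₃) V) (x₁ , x₂ , x₃) =
  mem V (x₁ ⊕ a₁) ∧ mem V (x₂ ⊕ a₂) ∧ mem V (x₃ ⊕ a₃)

record AffinePartition (n m d : ℕ) : Set where
  field
    part     : Fin m → AffPart n
    codim    : ∀ j → CodimAtMost (sub (part j)) d
    partOf   : Triple n → Fin m
    isPartOf : ∀ x j → (inPart (part j) x ≡ true) ⇔ (partOf x ≡ j)
open AffinePartition public

inSupp : ∀ {n} → Triple n → Bool
inSupp (x₁ , x₂ , x₃) = allFalse (x₁ ⊕ x₂ ⊕ x₃)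
  where
  allFalse : ∀ {k} → Vec Bool k → Bool
  allFalse []          = true
  allFalse (true ∷ _)  = false
  allFalse (false ∷ v) = allFalse v

probP : (n : ℕ) → (Triple n → Bool) → ℚ
probP n A = ℕ→ℚ (count (λ x → inSupp x ∧ A x) (allTriples n))
         /? ℕ→ℚ (count inSupp (allTriples n))

probCond : (n : ℕ) → (Triple n → Bool) → (Triple n → Bool) → ℚ
probCond n A E = probP n (λ x → A x ∧ E x) /? probP n E

prodSet : ∀ {n} → (F2^ n → Bool) → (F2^ n → Bool) → (F2^ n → Bool) → Triple n → Bool
prodSet E₁ E₂ E₃ (x₁ , x₂ , x₃) = E₁ x₁ ∧ E₂ x₂ ∧ E₃ x₃

-- Characters of a subspace V: homomorphisms V → {-1,1}, encoded as
-- Boolean functions (true ↦ -1, false ↦ 1) additive on V.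

IsCharacter : ∀ {n} → Subspace n → (F2^ n → Bool) → Set
IsCharacter V χ = ∀ x y → mem V x ≡ true → mem V y ≡ true → χ (x ⊕ y) ≡ (χ x xor χ y)

IsNonZero : ∀ {n} → Subspace n → (F2^ n → Bool) → Set
IsNonZero V χ = ∃ λ x → (mem V x ≡ true) × (χ x ≡ true)

sign : Bool → ℤ
sign true  = ℤ.-[1+ 0 ]
sign false = + 1

-- Fourier coefficient of S|_U at χ, U = a + V:
--   E_{x ∼ U} [ S(x) χ(x + a) ]
fourierCoeff : ∀ {n} → Subspace n → F2^ n → (F2^ n → Bool) → (F2^ n → Bool) → ℚ
fourierCoeff {n} V a S χ =
  ℤ→ℚ (foldr ℤ._+_ (+ 0)
        (map (λ x → if mem V (x ⊕ a) ∧ S x then sign (χ (x ⊕ a)) else + 0) (allVecs n)))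
  /? ℕ→ℚ (count (λ x → mem V (x ⊕ a)) (allVecs n))

Uniform : ∀ {n} → ℚ → (Fin 3 → F2^ n → Bool) → AffPart n → Set
Uniform {n} δ E π =
  ∀ (i : Fin 3) (χ : F2^ n → Bool) → IsCharacter (sub π) χ → IsNonZero (sub π) χ →
    ℚ.∣ fourierCoeff (sub π) (coord i (shift π)) (E i) χ ∣ ℚ.≤ δ

tri : ∀ {n} → (F2^ n → Bool) → (F2^ n → Bool) → (F2^ n → Bool) → Fin 3 → F2^ n → Bool
tri E₁ E₂ E₃ fz          = E₁
tri E₁ E₂ E₃ (fs fz)     = E₂
tri E₁ E₂ E₃ (fs (fs _)) = E₃

{-# OPTIONS --safe #-}

-- Energy increment.  Start from the trivial partition and, in each round, cut every part a + V³ on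
-- which some Eᵢ has a Fourier coefficient of size > δ at a non-zero character χ of V into the eight
-- parts (a + e·p) + W³ with W = ker χ, χ(p) = 1, e ∈ {0,1}³; this raises the codimension by one.
-- The energy ∑_π 𝒫(π) ∑ᵢ (density of Eᵢ in πᵢ)² is at most 3, and cutting a part of measure μ
-- raises it by at least δ² μ: writing xᵢ, yᵢ for the sizes of Eᵢ on the two halves of πᵢ, the
-- children carry 2 ∑ᵢ (xᵢ² + yᵢ²) = ∑ᵢ (xᵢ + yᵢ)² + ∑ᵢ (xᵢ - yᵢ)², and the biased coefficient is
-- (xᵢ - yᵢ)/|V|.  So while the biased parts have measure > δ a round gains > δ³, and after at
-- most 3/δ³ rounds they have measure ≤ δ, i.e. conditional measure ≤ δ/α given E.
module Submission where

open import Defs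

open import Algebra.Bundles using (CommutativeRing)
import Algebra.Properties.CommutativeSemigroup as CommutativeSemigroupProperties
open import Data.Bool as Bool using (Bool; true; false; _xor_; _∧_; _∨_; not; if_then_else_)
open import Data.Bool.Properties
  using (xor-assoc; xor-comm; xor-same; xor-identityˡ; xor-identityʳ; xor-∧-commutativeRing;
         ∧-comm; ∧-distribˡ-xor; ∧-identityʳ; not-involutive)
open import Data.Empty using (⊥-elim)
open import Data.Fin using (Fin) renaming (zero to fz; suc to fs)
import Data.Fin.Properties as Fin
open import Data.Integer as ℤ using (ℤ; +_; -[1+_])
import Data.Integer.Properties as ℤₚ
import Data.Integer.Tactic.RingSolver as ℤ-Ring
open import Data.List using (List; []; _∷_; map; concatMap; foldr; _++_; length; lookup)
open import Data.List.Membership.Propositional using (_∈_; lose)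
open import Data.List.Membership.Propositional.Properties using (∈-concatMap⁺; ∈-lookup)
open import Data.List.Properties using (map-cong)
open import Data.List.Relation.Unary.All as ListAll using ([]; _∷_)
import Data.List.Relation.Unary.All.Properties as ListAllₚ
open import Data.List.Relation.Unary.Any as Any using (Any; here; there; any?; satisfied)
open import Data.Nat as ℕ using (ℕ; zero; suc; _∸_)
import Data.Nat.Coprimality as Coprime
open import Data.Nat.DivMod using (m/n*n≤m; m≡m%n+[m/n]*n; m%n<n)
import Data.Nat.Properties as ℕₚ
open import Data.Nat.Tactic.RingSolver using (solve-∀)
open import Data.Product using (_×_; _,_; Σ; ∃; ∃₂; proj₁; proj₂)
open import Data.Rational as ℚ using (ℚ; mkℚ; 0ℚ; 1ℚ; _+_; _*_; _-_; -_; 1/_; ∣_∣; _≤_; _<_)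
open import Data.Rational.Literals using (fromℤ)
import Data.Rational.Properties as ℚₚ
open import Data.Rational.Solver using (module +-*-Solver)
open +-*-Solver using (solve; _:+_; _:*_; _:-_; :-_; _:=_; con)
open import Data.Sum using (inj₁; inj₂)
open import Data.Vec as Vec using (Vec; []; _∷_)
open import Data.Vec.Properties using (zipWith-comm; zipWith-assoc; zipWith-identityˡ; zipWith-identityʳ; ≡-dec)
open import Data.Vec.Relation.Unary.All as All using (All; []; _∷_)
open import Function using (_∘_; mk⇔)
open import Relation.Binary.PropositionalEquality
open import Relation.Nullary using (Dec; yes; no; ¬_; does; _×-dec_)
open ≡-Reasoning

+-interchange : ∀ a b c d → (a ℕ.+ b) ℕ.+ (c ℕ.+ d) ≡ (a ℕ.+ c) ℕ.+ (b ℕ.+ d)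
+-interchange = CommutativeSemigroupProperties.interchange ℕₚ.+-commutativeSemigroup

xor-interchange : ∀ a b c d → (a xor b) xor (c xor d) ≡ (a xor c) xor (b xor d)
xor-interchange =
  CommutativeSemigroupProperties.interchange (CommutativeRing.+-commutativeSemigroup xor-∧-commutativeRing)

⊕-comm : ∀ {n} (x y : F2^ n) → x ⊕ y ≡ y ⊕ x
⊕-comm = zipWith-comm xor-comm

⊕-assoc : ∀ {n} (x y z : F2^ n) → (x ⊕ y) ⊕ z ≡ x ⊕ (y ⊕ z)
⊕-assoc = zipWith-assoc xor-assoc

⊕-identityˡ : ∀ {n} (x : F2^ n) → 0v ⊕ x ≡ x
⊕-identityˡ = zipWith-identityˡ xor-identityˡ

⊕-identityʳ : ∀ {n} (x : F2^ n) → x ⊕ 0v ≡ x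
⊕-identityʳ = zipWith-identityʳ xor-identityʳ

⊕-self : ∀ {n} (x : F2^ n) → x ⊕ x ≡ 0v
⊕-self []      = refl
⊕-self (a ∷ x) = cong₂ _∷_ (xor-same a) (⊕-self x)

⊕-cancelʳ : ∀ {n} (x y : F2^ n) → (x ⊕ y) ⊕ y ≡ x
⊕-cancelʳ x y = begin
  (x ⊕ y) ⊕ y  ≡⟨ ⊕-assoc x y y ⟩
  x ⊕ (y ⊕ y)  ≡⟨ cong (x ⊕_) (⊕-self y) ⟩
  x ⊕ 0v       ≡⟨ ⊕-identityʳ x ⟩
  x            ∎

⊕-interchange : ∀ {n} (a b c d : F2^ n) → (a ⊕ b) ⊕ (c ⊕ d) ≡ (a ⊕ c) ⊕ (b ⊕ d)
⊕-interchange a b c d = begin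
  (a ⊕ b) ⊕ (c ⊕ d)  ≡⟨ ⊕-assoc a b (c ⊕ d) ⟩
  a ⊕ (b ⊕ (c ⊕ d))  ≡⟨ cong (a ⊕_) (sym (⊕-assoc b c d)) ⟩
  a ⊕ ((b ⊕ c) ⊕ d)  ≡⟨ cong (λ v → a ⊕ (v ⊕ d)) (⊕-comm b c) ⟩
  a ⊕ ((c ⊕ b) ⊕ d)  ≡⟨ cong (a ⊕_) (⊕-assoc c b d) ⟩
  a ⊕ (c ⊕ (b ⊕ d))  ≡⟨ sym (⊕-assoc a c (b ⊕ d)) ⟩
  (a ⊕ c) ⊕ (b ⊕ d)  ∎

⊕≡0v⇒≡ : ∀ {n} (x y : F2^ n) → x ⊕ y ≡ 0v → x ≡ y
⊕≡0v⇒≡ x y x⊕y≡0 = begin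
  x            ≡⟨ sym (⊕-cancelʳ x y) ⟩
  (x ⊕ y) ⊕ y  ≡⟨ cong (_⊕ y) x⊕y≡0 ⟩
  0v ⊕ y       ≡⟨ ⊕-identityˡ y ⟩
  y            ∎

infix 4 _==_
_==_ : ∀ {n} → F2^ n → F2^ n → Bool
[]      == []      = true
(a ∷ x) == (b ∷ y) = not (a xor b) ∧ (x == y)

∈-allVecs : ∀ n (x : F2^ n) → x ∈ allVecs n
∈-allVecs zero    []      = here refl
∈-allVecs (suc n) (b ∷ x) = ∈-concatMap⁺ _ (Any.map (λ { refl → pair b }) (∈-allVecs n x))
  where
  pair : ∀ b → b ∷ x ∈ (false ∷ x) ∷ (true ∷ x) ∷ []
  pair false = here refl
  pair true  = there (here refl)

∑ : ∀ {A : Set} → List A → (A → ℕ) → ℕ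
∑ []       f = 0
∑ (x ∷ xs) f = f x ℕ.+ ∑ xs f

𝟙 : Bool → ℕ
𝟙 true  = 1
𝟙 false = 0

𝟙-∧ : ∀ a b → 𝟙 (a ∧ b) ≡ 𝟙 a ℕ.* 𝟙 b
𝟙-∧ true  b = sym (ℕₚ.+-identityʳ (𝟙 b))
𝟙-∧ false b = refl

count≡∑𝟙 : ∀ {A : Set} (p : A → Bool) xs → count p xs ≡ ∑ xs (λ a → 𝟙 (p a))
count≡∑𝟙 p []       = refl
count≡∑𝟙 p (x ∷ xs) with p x
... | true  = cong suc (count≡∑𝟙 p xs)
... | false = count≡∑𝟙 p xs

∑-cong : ∀ {A : Set} (xs : List A) {f g : A → ℕ} → (∀ a → f a ≡ g a) → ∑ xs f ≡ ∑ xs g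
∑-cong []       f≗g = refl
∑-cong (x ∷ xs) f≗g = cong₂ ℕ._+_ (f≗g x) (∑-cong xs f≗g)

∑-mono : ∀ {A : Set} (xs : List A) {f g : A → ℕ} → (∀ a → f a ℕ.≤ g a) → ∑ xs f ℕ.≤ ∑ xs g
∑-mono []       f≤g = ℕ.z≤n
∑-mono (x ∷ xs) f≤g = ℕₚ.+-mono-≤ (f≤g x) (∑-mono xs f≤g)

∑-++ : ∀ {A : Set} (xs ys : List A) f → ∑ (xs ++ ys) f ≡ ∑ xs f ℕ.+ ∑ ys f
∑-++ []       ys f = refl
∑-++ (x ∷ xs) ys f = trans (cong (f x ℕ.+_) (∑-++ xs ys f)) (sym (ℕₚ.+-assoc (f x) _ _))

∑-concatMap : ∀ {A B : Set} (g : A → List B) xs f → ∑ (concatMap g xs) f ≡ ∑ xs (λ a → ∑ (g a) f)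
∑-concatMap g []       f = refl
∑-concatMap g (x ∷ xs) f = trans (∑-++ (g x) (concatMap g xs) f) (cong (∑ (g x) f ℕ.+_) (∑-concatMap g xs f))

∑-map : ∀ {A B : Set} (g : A → B) xs f → ∑ (map g xs) f ≡ ∑ xs (λ a → f (g a))
∑-map g []       f = refl
∑-map g (x ∷ xs) f = cong (f (g x) ℕ.+_) (∑-map g xs f)

∑-+ : ∀ {A : Set} (xs : List A) f g → ∑ xs (λ a → f a ℕ.+ g a) ≡ ∑ xs f ℕ.+ ∑ xs g
∑-+ []       f g = refl
∑-+ (x ∷ xs) f g = trans (cong (f x ℕ.+ g x ℕ.+_) (∑-+ xs f g)) (+-interchange (f x) (g x) (∑ xs f) (∑ xs g))

∑-*ˡ : ∀ {A : Set} (xs : List A) c f → ∑ xs (λ a → c ℕ.* f a) ≡ c ℕ.* ∑ xs f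
∑-*ˡ []       c f = sym (ℕₚ.*-zeroʳ c)
∑-*ˡ (x ∷ xs) c f = trans (cong (c ℕ.* f x ℕ.+_) (∑-*ˡ xs c f)) (sym (ℕₚ.*-distribˡ-+ c (f x) _))

∑-*ʳ : ∀ {A : Set} (xs : List A) c f → ∑ xs (λ a → f a ℕ.* c) ≡ ∑ xs f ℕ.* c
∑-*ʳ xs c f = begin
  ∑ xs (λ a → f a ℕ.* c)  ≡⟨ ∑-cong xs (λ a → ℕₚ.*-comm (f a) c) ⟩
  ∑ xs (λ a → c ℕ.* f a)  ≡⟨ ∑-*ˡ xs c f ⟩
  c ℕ.* ∑ xs f            ≡⟨ ℕₚ.*-comm c (∑ xs f) ⟩
  ∑ xs f ℕ.* c            ∎

∑-zero : ∀ {A : Set} (xs : List A) → ∑ xs (λ _ → 0) ≡ 0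
∑-zero []       = refl
∑-zero (x ∷ xs) = ∑-zero xs

∑-swap : ∀ {A B : Set} (xs : List A) (ys : List B) (f : A → B → ℕ) →
         ∑ xs (λ a → ∑ ys (f a)) ≡ ∑ ys (λ b → ∑ xs (λ a → f a b))
∑-swap []       ys f = sym (∑-zero ys)
∑-swap (x ∷ xs) ys f = trans (cong (∑ ys (f x) ℕ.+_) (∑-swap xs ys f)) (sym (∑-+ ys (f x) _))

foldr-+-difference : ∀ {A : Set} (xs : List A) (f g : A → ℕ) →
                     foldr ℤ._+_ (+ 0) (map (λ x → + f x ℤ.- + g x) xs) ≡ + ∑ xs f ℤ.- + ∑ xs g
foldr-+-difference []       f g = refl
foldr-+-difference (x ∷ xs) f g = begin
  (+ f x ℤ.- + g x) ℤ.+ foldr ℤ._+_ (+ 0) (map (λ x → + f x ℤ.- + g x) xs)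
    ≡⟨ cong (λ s → (+ f x ℤ.- + g x) ℤ.+ s) (foldr-+-difference xs f g) ⟩
  (+ f x ℤ.- + g x) ℤ.+ (+ ∑ xs f ℤ.- + ∑ xs g)
    ≡⟨ regroup (+ f x) (+ g x) (+ ∑ xs f) (+ ∑ xs g) ⟩
  (+ f x ℤ.+ + ∑ xs f) ℤ.- (+ g x ℤ.+ + ∑ xs g)
    ≡⟨ cong₂ ℤ._-_ (ℤₚ.pos-+ (f x) (∑ xs f)) (ℤₚ.pos-+ (g x) (∑ xs g)) ⟨
  + ∑ (x ∷ xs) f ℤ.- + ∑ (x ∷ xs) g
    ∎
  where
  regroup : ∀ a b c d → (a ℤ.- b) ℤ.+ (c ℤ.- d) ≡ (a ℤ.+ c) ℤ.- (b ℤ.+ d)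
  regroup = ℤ-Ring.solve-∀

bools : List Bool
bools = false ∷ true ∷ []

signs³ : List (Bool × Bool × Bool)
signs³ = concatMap (λ e₁ → concatMap (λ e₂ → map (λ e₃ → e₁ , e₂ , e₃) bools) bools) bools

∑-signs³ : ∀ (f : Bool × Bool × Bool → ℕ) →
           ∑ signs³ f ≡ ∑ bools (λ e₁ → ∑ bools (λ e₂ → ∑ bools (λ e₃ → f (e₁ , e₂ , e₃))))
∑-signs³ f = trans (∑-concatMap (λ e₁ → concatMap (triples e₁) bools) bools f)
  (∑-cong bools (λ e₁ → trans (∑-concatMap (triples e₁) bools f)
                              (∑-cong bools (λ e₂ → ∑-map (λ e₃ → e₁ , e₂ , e₃) bools f))))
  where
  triples : Bool → Bool → List (Bool × Bool × Bool)
  triples e₁ e₂ = map (λ e₃ → e₁ , e₂ , e₃) bools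

∑-signs³-product : ∀ (f g h : Bool → ℕ) →
  ∑ signs³ (λ (e₁ , e₂ , e₃) → f e₁ ℕ.* (g e₂ ℕ.* h e₃)) ≡ ∑ bools f ℕ.* (∑ bools g ℕ.* ∑ bools h)
∑-signs³-product f g h = begin
  ∑ signs³ (λ (e₁ , e₂ , e₃) → f e₁ ℕ.* (g e₂ ℕ.* h e₃))
    ≡⟨ ∑-signs³ (λ (e₁ , e₂ , e₃) → f e₁ ℕ.* (g e₂ ℕ.* h e₃)) ⟩
  ∑ bools (λ e₁ → ∑ bools (λ e₂ → ∑ bools (λ e₃ → f e₁ ℕ.* (g e₂ ℕ.* h e₃))))
    ≡⟨ ∑-cong bools (λ e₁ → ∑-cong bools (λ e₂ → inner e₁ e₂)) ⟩
  ∑ bools (λ e₁ → ∑ bools (λ e₂ → f e₁ ℕ.* (g e₂ ℕ.* ∑ bools h)))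
    ≡⟨ ∑-cong bools middle ⟩
  ∑ bools (λ e₁ → f e₁ ℕ.* (∑ bools g ℕ.* ∑ bools h))
    ≡⟨ ∑-*ʳ bools (∑ bools g ℕ.* ∑ bools h) f ⟩
  ∑ bools f ℕ.* (∑ bools g ℕ.* ∑ bools h)
    ∎
  where
  inner : ∀ e₁ e₂ → ∑ bools (λ e₃ → f e₁ ℕ.* (g e₂ ℕ.* h e₃)) ≡ f e₁ ℕ.* (g e₂ ℕ.* ∑ bools h)
  inner e₁ e₂ = trans (∑-*ˡ bools (f e₁) (λ e₃ → g e₂ ℕ.* h e₃)) (cong (f e₁ ℕ.*_) (∑-*ˡ bools (g e₂) h))
  middle : ∀ e₁ → ∑ bools (λ e₂ → f e₁ ℕ.* (g e₂ ℕ.* ∑ bools h)) ≡ f e₁ ℕ.* (∑ bools g ℕ.* ∑ bools h)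
  middle e₁ = trans (∑-*ˡ bools (f e₁) (λ e₂ → g e₂ ℕ.* ∑ bools h)) (cong (f e₁ ℕ.*_) (∑-*ʳ bools (∑ bools h) g))

-- Only the four sign patterns with e₁ xor e₂ xor e₃ ≡ b survive, and each value of each eᵢ
-- occurs in exactly two of them.
parity-sum : ∀ b (f g h : Bool → ℕ) →
  ∑ signs³ (λ (e₁ , e₂ , e₃) → 𝟙 (not (b xor ((e₁ xor e₂) xor e₃))) ℕ.* (f e₁ ℕ.+ g e₂ ℕ.+ h e₃))
  ≡ 2 ℕ.* (∑ bools f ℕ.+ ∑ bools g ℕ.+ ∑ bools h)
parity-sum false f g h = even (f false) (f true) (g false) (g true) (h false) (h true)
  where
  even : ∀ x₀ x₁ y₀ y₁ z₀ z₁ →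
      1 ℕ.* (x₀ ℕ.+ y₀ ℕ.+ z₀) ℕ.+ (0 ℕ.* (x₀ ℕ.+ y₀ ℕ.+ z₁) ℕ.+ (0 ℕ.* (x₀ ℕ.+ y₁ ℕ.+ z₀) ℕ.+
      (1 ℕ.* (x₀ ℕ.+ y₁ ℕ.+ z₁) ℕ.+ (0 ℕ.* (x₁ ℕ.+ y₀ ℕ.+ z₀) ℕ.+ (1 ℕ.* (x₁ ℕ.+ y₀ ℕ.+ z₁) ℕ.+
      (1 ℕ.* (x₁ ℕ.+ y₁ ℕ.+ z₀) ℕ.+ (0 ℕ.* (x₁ ℕ.+ y₁ ℕ.+ z₁) ℕ.+ 0)))))))
    ≡ 2 ℕ.* (x₀ ℕ.+ (x₁ ℕ.+ 0) ℕ.+ (y₀ ℕ.+ (y₁ ℕ.+ 0)) ℕ.+ (z₀ ℕ.+ (z₁ ℕ.+ 0)))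
  even = solve-∀
parity-sum true f g h = odd (f false) (f true) (g false) (g true) (h false) (h true)
  where
  odd : ∀ x₀ x₁ y₀ y₁ z₀ z₁ →
      0 ℕ.* (x₀ ℕ.+ y₀ ℕ.+ z₀) ℕ.+ (1 ℕ.* (x₀ ℕ.+ y₀ ℕ.+ z₁) ℕ.+ (1 ℕ.* (x₀ ℕ.+ y₁ ℕ.+ z₀) ℕ.+
      (0 ℕ.* (x₀ ℕ.+ y₁ ℕ.+ z₁) ℕ.+ (1 ℕ.* (x₁ ℕ.+ y₀ ℕ.+ z₀) ℕ.+ (0 ℕ.* (x₁ ℕ.+ y₀ ℕ.+ z₁) ℕ.+
      (0 ℕ.* (x₁ ℕ.+ y₁ ℕ.+ z₀) ℕ.+ (1 ℕ.* (x₁ ℕ.+ y₁ ℕ.+ z₁) ℕ.+ 0)))))))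
    ≡ 2 ℕ.* (x₀ ℕ.+ (x₁ ℕ.+ 0) ℕ.+ (y₀ ℕ.+ (y₁ ℕ.+ 0)) ℕ.+ (z₀ ℕ.+ (z₁ ℕ.+ 0)))
  odd = solve-∀

∑-allVecs-suc : ∀ n (f : F2^ (suc n) → ℕ) →
                ∑ (allVecs (suc n)) f ≡ ∑ (allVecs n) (λ v → f (false ∷ v) ℕ.+ f (true ∷ v))
∑-allVecs-suc n f = trans (∑-concatMap _ (allVecs n) f)
  (∑-cong (allVecs n) (λ v → cong (f (false ∷ v) ℕ.+_) (ℕₚ.+-identityʳ _)))

∑-allVecs-translate : ∀ n (t : F2^ n) (f : F2^ n → ℕ) → ∑ (allVecs n) (λ x → f (x ⊕ t)) ≡ ∑ (allVecs n) f
∑-allVecs-translate zero    []          f = refl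
∑-allVecs-translate (suc n) (false ∷ t) f = begin
  ∑ (allVecs (suc n)) (λ x → f (x ⊕ (false ∷ t)))
    ≡⟨ ∑-allVecs-suc n _ ⟩
  ∑ (allVecs n) (λ v → f (false ∷ (v ⊕ t)) ℕ.+ f (true ∷ (v ⊕ t)))
    ≡⟨ ∑-allVecs-translate n t (λ v → f (false ∷ v) ℕ.+ f (true ∷ v)) ⟩
  ∑ (allVecs n) (λ v → f (false ∷ v) ℕ.+ f (true ∷ v))
    ≡⟨ ∑-allVecs-suc n f ⟨
  ∑ (allVecs (suc n)) f ∎
∑-allVecs-translate (suc n) (true ∷ t) f = begin
  ∑ (allVecs (suc n)) (λ x → f (x ⊕ (true ∷ t)))
    ≡⟨ ∑-allVecs-suc n _ ⟩
  ∑ (allVecs n) (λ v → f (true ∷ (v ⊕ t)) ℕ.+ f (false ∷ (v ⊕ t)))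
    ≡⟨ ∑-cong (allVecs n) (λ v → ℕₚ.+-comm (f (true ∷ (v ⊕ t))) _) ⟩
  ∑ (allVecs n) (λ v → f (false ∷ (v ⊕ t)) ℕ.+ f (true ∷ (v ⊕ t)))
    ≡⟨ ∑-allVecs-translate n t (λ v → f (false ∷ v) ℕ.+ f (true ∷ v)) ⟩
  ∑ (allVecs n) (λ v → f (false ∷ v) ℕ.+ f (true ∷ v))
    ≡⟨ ∑-allVecs-suc n f ⟨
  ∑ (allVecs (suc n)) f ∎

∑-allVecs-point : ∀ n (w : F2^ n) (f : F2^ n → ℕ) → ∑ (allVecs n) (λ z → if z == w then f z else 0) ≡ f w
∑-allVecs-point zero    []          f = ℕₚ.+-identityʳ _
∑-allVecs-point (suc n) (false ∷ w) f = trans (∑-allVecs-suc n _)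
  (trans (∑-cong (allVecs n) (λ v → ℕₚ.+-identityʳ _)) (∑-allVecs-point n w (λ v → f (false ∷ v))))
∑-allVecs-point (suc n) (true ∷ w)  f = trans (∑-allVecs-suc n _) (∑-allVecs-point n w (λ v → f (true ∷ v)))

infixr 7 _·_
_·_ : ∀ {n} → Bool → F2^ n → F2^ n
true  · v = v
false · v = 0v

·-xor : ∀ {n} a b (v : F2^ n) → (a xor b) · v ≡ a · v ⊕ b · v
·-xor true  true  v = sym (⊕-self v)
·-xor true  false v = sym (⊕-identityʳ v)
·-xor false b     v = sym (⊕-identityˡ (b · v))

·-⊕ : ∀ {n} a (x y : F2^ n) → a · (x ⊕ y) ≡ a · x ⊕ a · y
·-⊕ true  x y = refl
·-⊕ false x y = sym (⊕-identityˡ 0v)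

·-· : ∀ {n} a c (v : F2^ n) → a · (c · v) ≡ (c ∧ a) · v
·-· true  true  v = refl
·-· true  false v = refl
·-· false true  v = refl
·-· false false v = refl

lincomb-∷ : ∀ {n k} c (cs : F2^ k) (b : F2^ n) bs → lincomb (c ∷ cs) (b ∷ bs) ≡ c · b ⊕ lincomb cs bs
lincomb-∷ true  cs b bs = refl
lincomb-∷ false cs b bs = sym (⊕-identityˡ _)

lincomb-0v : ∀ {n k} (B : Vec (F2^ n) k) → lincomb 0v B ≡ 0v
lincomb-0v []      = refl
lincomb-0v (b ∷ B) = lincomb-0v B

lincomb-⊕ : ∀ {n k} (c d : F2^ k) (B : Vec (F2^ n) k) → lincomb (c ⊕ d) B ≡ lincomb c B ⊕ lincomb d B
lincomb-⊕ []       []       []      = sym (⊕-identityˡ 0v)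
lincomb-⊕ (c ∷ cs) (d ∷ ds) (b ∷ B) = begin
  lincomb ((c xor d) ∷ (cs ⊕ ds)) (b ∷ B)                 ≡⟨ lincomb-∷ (c xor d) (cs ⊕ ds) b B ⟩
  (c xor d) · b ⊕ lincomb (cs ⊕ ds) B                    ≡⟨ cong₂ _⊕_ (·-xor c d b) (lincomb-⊕ cs ds B) ⟩
  (c · b ⊕ d · b) ⊕ (lincomb cs B ⊕ lincomb ds B)        ≡⟨ ⊕-interchange (c · b) (d · b) _ _ ⟩
  (c · b ⊕ lincomb cs B) ⊕ (d · b ⊕ lincomb ds B)        ≡⟨ sym (cong₂ _⊕_ (lincomb-∷ c cs b B) (lincomb-∷ d ds b B)) ⟩
  lincomb (c ∷ cs) (b ∷ B) ⊕ lincomb (d ∷ ds) (b ∷ B)    ∎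

lincomb-∈ : ∀ {n k} (V : Subspace n) (B : Vec (F2^ n) k) → All (λ b → mem V b ≡ true) B →
            ∀ c → mem V (lincomb c B) ≡ true
lincomb-∈ V []      []        []          = zero∈ V
lincomb-∈ V (b ∷ B) (b∈ ∷ B∈) (true ∷ c)  = closed V b _ b∈ (lincomb-∈ V B B∈ c)
lincomb-∈ V (b ∷ B) (b∈ ∷ B∈) (false ∷ c) = lincomb-∈ V B B∈ c

mem-⊕ʳ : ∀ {n} (V : Subspace n) {w} u → mem V w ≡ true → mem V (u ⊕ w) ≡ mem V u
mem-⊕ʳ V {w} u w∈V with mem V u in u∈V | mem V (u ⊕ w) in u⊕w∈V
... | true  | _     = trans (sym u⊕w∈V) (closed V u w u∈V w∈V)
... | false | false = refl
... | false | true  with () ← trans (sym u∈V) (trans (cong (mem V) (sym (⊕-cancelʳ u w))) (closed V _ w u⊕w∈V w∈V))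

mem-⊕ˡ : ∀ {n} (V : Subspace n) {w} u → mem V w ≡ true → mem V (w ⊕ u) ≡ mem V u
mem-⊕ˡ V {w} u w∈V = trans (cong (mem V) (⊕-comm w u)) (mem-⊕ʳ V u w∈V)

basis-∈-span : ∀ {n k} (B : Vec (F2^ n) k) → All (λ b → ∃ λ d → lincomb d B ≡ b) B
basis-∈-span []      = []
basis-∈-span (b ∷ B) = (true ∷ 0v , trans (cong (b ⊕_) (lincomb-0v B)) (⊕-identityʳ b))
                     ∷ All.map (λ { (d , eq) → false ∷ d , eq }) (basis-∈-span B)

Independent : ∀ {n k} → Vec (F2^ n) k → Set
Independent {k = k} B = ∀ (c : F2^ k) → lincomb c B ≡ 0v → c ≡ 0v

Spans : ∀ {n k} → Subspace n → Vec (F2^ n) k → Set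
Spans V B = ∀ v → mem V v ≡ true → ∃ λ c → lincomb c B ≡ v

lincomb-injective : ∀ {n k} (B : Vec (F2^ n) k) → Independent B → ∀ c d → lincomb c B ≡ lincomb d B → c ≡ d
lincomb-injective B indep c d eq = ⊕≡0v⇒≡ c d (indep (c ⊕ d) (begin
  lincomb (c ⊕ d) B              ≡⟨ lincomb-⊕ c d B ⟩
  lincomb c B ⊕ lincomb d B      ≡⟨ cong (_⊕ lincomb d B) eq ⟩
  lincomb d B ⊕ lincomb d B      ≡⟨ ⊕-self _ ⟩
  0v                             ∎))

coords : ∀ {n k} → Vec (F2^ n) k → F2^ n → F2^ k
coords {k = k} B x with any? (λ c → ≡-dec Bool._≟_ (lincomb c B) x) (allVecs k)
... | yes found = proj₁ (satisfied found)
... | no  _     = 0v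

lincomb-coords-lincomb : ∀ {n k} (B : Vec (F2^ n) k) d → lincomb (coords B (lincomb d B)) B ≡ lincomb d B
lincomb-coords-lincomb {k = k} B d with any? (λ c → ≡-dec Bool._≟_ (lincomb c B) (lincomb d B)) (allVecs k)
... | yes found = proj₂ (satisfied found)
... | no  none  = ⊥-elim (none (lose (∈-allVecs k d) refl))

lincomb-coords : ∀ {n k} (V : Subspace n) (B : Vec (F2^ n) k) → Spans V B →
                 ∀ x → mem V x ≡ true → lincomb (coords B x) B ≡ x
lincomb-coords V B spans x x∈V with spans x x∈V
... | d , refl = lincomb-coords-lincomb B d

coords-lincomb : ∀ {n k} (B : Vec (F2^ n) k) → Independent B → ∀ d → coords B (lincomb d B) ≡ d
coords-lincomb B indep d = lincomb-injective B indep _ d (lincomb-coords-lincomb B d)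

dot : ∀ {k} → F2^ k → F2^ k → Bool
dot []      []      = false
dot (a ∷ c) (b ∷ d) = (a ∧ b) xor dot c d

dot-comm : ∀ {k} (c d : F2^ k) → dot c d ≡ dot d c
dot-comm []      []      = refl
dot-comm (a ∷ c) (b ∷ d) = cong₂ _xor_ (∧-comm a b) (dot-comm c d)

dot-0vʳ : ∀ {k} (c : F2^ k) → dot c 0v ≡ false
dot-0vʳ []          = refl
dot-0vʳ (true ∷ c)  = dot-0vʳ c
dot-0vʳ (false ∷ c) = dot-0vʳ c

dot-0vˡ : ∀ {k} (c : F2^ k) → dot 0v c ≡ false
dot-0vˡ c = trans (dot-comm 0v c) (dot-0vʳ c)

dot-⊕ʳ : ∀ {k} (c d e : F2^ k) → dot c (d ⊕ e) ≡ dot c d xor dot c e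
dot-⊕ʳ []      []      []      = refl
dot-⊕ʳ (a ∷ c) (b ∷ d) (x ∷ e) =
  trans (cong₂ _xor_ (∧-distribˡ-xor a b x) (dot-⊕ʳ c d e)) (xor-interchange (a ∧ b) (a ∧ x) _ _)

character : ∀ {n k} → Vec (F2^ n) k → F2^ k → F2^ n → Bool
character B c x = dot c (coords B x)

character-lincomb : ∀ {n k} (B : Vec (F2^ n) k) → Independent B → ∀ c d → character B c (lincomb d B) ≡ dot c d
character-lincomb B indep c d = cong (dot c) (coords-lincomb B indep d)

character-isCharacter : ∀ {n k} (V : Subspace n) (B : Vec (F2^ n) k) → IsBasis V B → ∀ c → IsCharacter V (character B c)
character-isCharacter V B (_ , indep , spans) c x y x∈V y∈V with spans x x∈V | spans y y∈V
... | d , refl | e , refl = begin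
  character B c (lincomb d B ⊕ lincomb e B)                ≡⟨ cong (character B c) (lincomb-⊕ d e B) ⟨
  character B c (lincomb (d ⊕ e) B)                        ≡⟨ character-lincomb B indep c (d ⊕ e) ⟩
  dot c (d ⊕ e)                                            ≡⟨ dot-⊕ʳ c d e ⟩
  dot c d xor dot c e                                      ≡⟨ sym (cong₂ _xor_ (character-lincomb B indep c d)
                                                                                (character-lincomb B indep c e)) ⟩
  character B c (lincomb d B) xor character B c (lincomb e B) ∎

isCharacter-lincomb : ∀ {n k} (V : Subspace n) (χ : F2^ n → Bool) → IsCharacter V χ →
                      (B : Vec (F2^ n) k) → All (λ b → mem V b ≡ true) B →
                      ∀ d → χ (lincomb d B) ≡ dot d (Vec.map χ B)
isCharacter-lincomb V χ isχ []      []        []          =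
  trans (cong χ (sym (⊕-self 0v))) (trans (isχ 0v 0v (zero∈ V) (zero∈ V)) (xor-same (χ 0v)))
isCharacter-lincomb V χ isχ (b ∷ B) (b∈ ∷ B∈) (true ∷ d)  =
  trans (isχ b _ b∈ (lincomb-∈ V B B∈ d)) (cong (χ b xor_) (isCharacter-lincomb V χ isχ B B∈ d))
isCharacter-lincomb V χ isχ (b ∷ B) (b∈ ∷ B∈) (false ∷ d) = isCharacter-lincomb V χ isχ B B∈ d

isCharacter⇒character : ∀ {n k} (V : Subspace n) (B : Vec (F2^ n) k) → IsBasis V B →
                        ∀ χ → IsCharacter V χ → ∀ v → mem V v ≡ true → χ v ≡ character B (Vec.map χ B) v
isCharacter⇒character V B (B∈ , _ , spans) χ isχ v v∈V = begin
  χ v                                     ≡⟨ cong χ (lincomb-coords V B spans v v∈V) ⟨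
  χ (lincomb (coords B v) B)              ≡⟨ isCharacter-lincomb V χ isχ B B∈ (coords B v) ⟩
  dot (coords B v) (Vec.map χ B)          ≡⟨ dot-comm (coords B v) _ ⟩
  character B (Vec.map χ B) v             ∎

nonzero : ∀ {k} → F2^ k → Bool
nonzero []      = false
nonzero (a ∷ c) = a ∨ nonzero c

nonzero-false : ∀ {k} (c : F2^ k) → nonzero c ≡ false → c ≡ 0v
nonzero-false []          _  = refl
nonzero-false (false ∷ c) eq = cong (false ∷_) (nonzero-false c eq)

fourierCoeff-cong : ∀ {n} (V : Subspace n) a S (χ χ′ : F2^ n → Bool) → (∀ v → mem V v ≡ true → χ v ≡ χ′ v) →
                    fourierCoeff V a S χ ≡ fourierCoeff V a S χ′
fourierCoeff-cong {n} V a S χ χ′ χ≗χ′ =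
  cong (λ ys → ℤ→ℚ (foldr ℤ._+_ (+ 0) ys) /? ℕ→ℚ (count (λ x → mem V (x ⊕ a)) (allVecs n)))
       (map-cong pointwise (allVecs n))
  where
  pointwise : ∀ x → (if mem V (x ⊕ a) ∧ S x then sign (χ (x ⊕ a)) else + 0)
                  ≡ (if mem V (x ⊕ a) ∧ S x then sign (χ′ (x ⊕ a)) else + 0)
  pointwise x with mem V (x ⊕ a) in x∈V
  ... | false = refl
  ... | true  = cong (λ b → if S x then sign b else + 0) (χ≗χ′ (x ⊕ a) x∈V)

nonzero-coefficients : ∀ {n k} (V : Subspace n) (B : Vec (F2^ n) k) → IsBasis V B →
                       ∀ χ → IsCharacter V χ → IsNonZero V χ → nonzero (Vec.map χ B) ≡ true
nonzero-coefficients V B isB χ isχ (x , x∈V , χx) with nonzero (Vec.map χ B) in nz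
... | true  = refl
... | false with () ← trans (sym χx) (begin
  χ x                                 ≡⟨ isCharacter⇒character V B isB χ isχ x x∈V ⟩
  dot (Vec.map χ B) (coords B x)      ≡⟨ cong (λ c → dot c (coords B x)) (nonzero-false (Vec.map χ B) nz) ⟩
  dot 0v (coords B x)                 ≡⟨ dot-0vˡ (coords B x) ⟩
  false                               ∎)

-- Cutting a subspace by a non-zero character

addMultiples : ∀ {n k} → F2^ n → F2^ k → Vec (F2^ n) k → Vec (F2^ n) k
addMultiples b []       []       = []
addMultiples b (c ∷ cs) (x ∷ xs) = (x ⊕ c · b) ∷ addMultiples b cs xs

lincomb-addMultiples : ∀ {n k} (b : F2^ n) (d cs : F2^ k) xs →
                       lincomb d (addMultiples b cs xs) ≡ dot cs d · b ⊕ lincomb d xs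
lincomb-addMultiples b []       []       []       = sym (⊕-identityʳ _)
lincomb-addMultiples b (d ∷ ds) (c ∷ cs) (x ∷ xs) = begin
  lincomb (d ∷ ds) ((x ⊕ c · b) ∷ addMultiples b cs xs)
    ≡⟨ lincomb-∷ d ds (x ⊕ c · b) _ ⟩
  d · (x ⊕ c · b) ⊕ lincomb ds (addMultiples b cs xs)
    ≡⟨ cong₂ _⊕_ (trans (·-⊕ d x (c · b)) (cong (d · x ⊕_) (·-· d c b))) (lincomb-addMultiples b ds cs xs) ⟩
  (d · x ⊕ (c ∧ d) · b) ⊕ (dot cs ds · b ⊕ lincomb ds xs)
    ≡⟨ cong (_⊕ (dot cs ds · b ⊕ lincomb ds xs)) (⊕-comm (d · x) _) ⟩
  ((c ∧ d) · b ⊕ d · x) ⊕ (dot cs ds · b ⊕ lincomb ds xs)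
    ≡⟨ ⊕-interchange ((c ∧ d) · b) (d · x) _ _ ⟩
  ((c ∧ d) · b ⊕ dot cs ds · b) ⊕ (d · x ⊕ lincomb ds xs)
    ≡⟨ sym (cong₂ _⊕_ (·-xor (c ∧ d) (dot cs ds) b) (lincomb-∷ d ds x xs)) ⟩
  dot (c ∷ cs) (d ∷ ds) · b ⊕ lincomb (d ∷ ds) (x ∷ xs)
    ∎

-- With the first index i where cᵢ = true as pivot: kernelBasis replaces each other basis vector
-- bⱼ by bⱼ + cⱼ bᵢ and drops bᵢ, liftCoords gives the old coordinates of a new combination,
-- and pivot is the i-th unit vector.
kernelBasis : ∀ {n k} (c : F2^ (suc k)) → nonzero c ≡ true → Vec (F2^ n) (suc k) → Vec (F2^ n) k
kernelBasis             (true ∷ cs)  _  (b ∷ bs) = addMultiples b cs bs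
kernelBasis {k = suc k} (false ∷ cs) nz (b ∷ bs) = b ∷ kernelBasis cs nz bs
kernelBasis {k = zero}  (false ∷ []) () (b ∷ [])

liftCoords : ∀ {k} (c : F2^ (suc k)) → nonzero c ≡ true → F2^ k → F2^ (suc k)
liftCoords           (true ∷ cs)  _  d        = dot cs d ∷ d
liftCoords {suc k}   (false ∷ cs) nz (d ∷ ds) = d ∷ liftCoords cs nz ds
liftCoords {zero}    (false ∷ []) () d

pivot : ∀ {k} (c : F2^ (suc k)) → nonzero c ≡ true → F2^ (suc k)
pivot           (true ∷ cs)  _  = true ∷ 0v
pivot {suc k}   (false ∷ cs) nz = false ∷ pivot cs nz
pivot {zero}    (false ∷ []) ()

lincomb-kernelBasis : ∀ {n k} (c : F2^ (suc k)) (nz : nonzero c ≡ true) (B : Vec (F2^ n) (suc k)) d →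
                      lincomb d (kernelBasis c nz B) ≡ lincomb (liftCoords c nz d) B
lincomb-kernelBasis (true ∷ cs) nz (b ∷ bs) d =
  trans (lincomb-addMultiples b d cs bs) (sym (lincomb-∷ (dot cs d) d b bs))
lincomb-kernelBasis {k = suc k} (false ∷ cs) nz (b ∷ bs) (d ∷ ds) = begin
  lincomb (d ∷ ds) (b ∷ kernelBasis cs nz bs)         ≡⟨ lincomb-∷ d ds b _ ⟩
  d · b ⊕ lincomb ds (kernelBasis cs nz bs)           ≡⟨ cong (d · b ⊕_) (lincomb-kernelBasis cs nz bs ds) ⟩
  d · b ⊕ lincomb (liftCoords cs nz ds) bs            ≡⟨ lincomb-∷ d (liftCoords cs nz ds) b bs ⟨
  lincomb (d ∷ liftCoords cs nz ds) (b ∷ bs)          ∎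
lincomb-kernelBasis {k = zero} (false ∷ []) () (b ∷ []) d

dot-liftCoords : ∀ {k} (c : F2^ (suc k)) (nz : nonzero c ≡ true) d → dot c (liftCoords c nz d) ≡ false
dot-liftCoords         (true ∷ cs)  nz d        = xor-same (dot cs d)
dot-liftCoords {suc k} (false ∷ cs) nz (d ∷ ds) = dot-liftCoords cs nz ds
dot-liftCoords {zero}  (false ∷ []) () d

liftCoords-onto : ∀ {k} (c : F2^ (suc k)) (nz : nonzero c ≡ true) e → dot c e ≡ false →
                  ∃ λ d → liftCoords c nz d ≡ e
liftCoords-onto (true ∷ cs) nz (true ∷ e) ce = e , cong (_∷ e) (not-false (dot cs e) ce)
  where
  not-false : ∀ x → not x ≡ false → x ≡ true
  not-false true _ = refl
liftCoords-onto (true ∷ cs) nz (false ∷ e) ce = e , cong (_∷ e) ce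
liftCoords-onto {suc k} (false ∷ cs) nz (e ∷ es) ce with liftCoords-onto cs nz es ce
... | d , eq = e ∷ d , cong (e ∷_) eq
liftCoords-onto {zero} (false ∷ []) () e ce

liftCoords≡0v : ∀ {k} (c : F2^ (suc k)) (nz : nonzero c ≡ true) d → liftCoords c nz d ≡ 0v → d ≡ 0v
liftCoords≡0v         (true ∷ cs)  nz d        eq = cong Vec.tail eq
liftCoords≡0v {suc k} (false ∷ cs) nz (d ∷ ds) eq =
  cong₂ _∷_ (cong Vec.head eq) (liftCoords≡0v cs nz ds (cong Vec.tail eq))
liftCoords≡0v {zero}  (false ∷ []) () d eq

dot-pivot : ∀ {k} (c : F2^ (suc k)) (nz : nonzero c ≡ true) → dot c (pivot c nz) ≡ true
dot-pivot         (true ∷ cs)  nz = cong not (dot-0vʳ cs)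
dot-pivot {suc k} (false ∷ cs) nz = dot-pivot cs nz
dot-pivot {zero}  (false ∷ []) ()

-- V splits into the hyperplane W = ker χ and its translate p + W, where χ is the character with
-- coefficients c in the basis B and χ p = 1.
module Cut {n k : ℕ} (V : Subspace n) (B : Vec (F2^ n) (suc k)) (isB : IsBasis V B)
           (c : F2^ (suc k)) (nz : nonzero c ≡ true) where

  χ : F2^ n → Bool
  χ = character B c

  private
    B∈V   = proj₁ isB
    indep = proj₁ (proj₂ isB)
    spans = proj₂ (proj₂ isB)

  χ-isCharacter : IsCharacter V χ
  χ-isCharacter = character-isCharacter V B isB c

  χ-0v : χ 0v ≡ false
  χ-0v = trans (cong χ (sym (lincomb-0v B))) (trans (character-lincomb B indep c 0v) (dot-0vʳ c))

  W : Subspace n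
  W = record
    { mem    = λ x → mem V x ∧ not (χ x)
    ; zero∈  = cong₂ (λ a b → a ∧ not b) (zero∈ V) χ-0v
    ; closed = W-closed
    }
    where
    split : ∀ {a b} → a ∧ not b ≡ true → (a ≡ true) × (b ≡ false)
    split {true} {false} _ = refl , refl
    W-closed : ∀ x y → mem V x ∧ not (χ x) ≡ true → mem V y ∧ not (χ y) ≡ true →
               mem V (x ⊕ y) ∧ not (χ (x ⊕ y)) ≡ true
    W-closed x y x∈W y∈W with split x∈W | split y∈W
    ... | x∈V , χx | y∈V , χy
      rewrite closed V x y x∈V y∈V | χ-isCharacter x y x∈V y∈V | χx | χy = refl

  basisW : Vec (F2^ n) k
  basisW = kernelBasis c nz B

  isBasisW : IsBasis W basisW
  isBasisW = All.map (λ { (d , refl) → lincomb-basisW-∈ d }) (basis-∈-span basisW)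
           , (λ d eq → liftCoords≡0v c nz d (indep _ (trans (sym (lincomb-kernelBasis c nz B d)) eq)))
           , spansW
    where
    lincomb-basisW-∈ : ∀ d → mem W (lincomb d basisW) ≡ true
    lincomb-basisW-∈ d
      rewrite lincomb-kernelBasis c nz B d
            | lincomb-∈ V B B∈V (liftCoords c nz d)
            | character-lincomb B indep c (liftCoords c nz d)
            | dot-liftCoords c nz d = refl
    spansW : Spans W basisW
    spansW w w∈W with mem V w in w∈V | χ w in χw
    spansW w () | false | _
    spansW w () | true  | true
    ... | true | false with spans w w∈V
    ... | e , refl with liftCoords-onto c nz e (trans (sym (character-lincomb B indep c e)) χw)
    ... | d , refl = d , lincomb-kernelBasis c nz B d

  p : F2^ n
  p = lincomb (pivot c nz) B

  p∈V : mem V p ≡ true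
  p∈V = lincomb-∈ V B B∈V (pivot c nz)

  χ-p : χ p ≡ true
  χ-p = trans (character-lincomb B indep c (pivot c nz)) (dot-pivot c nz)

  mem-W-⊕p : ∀ v → mem W (v ⊕ p) ≡ mem V v ∧ χ v
  mem-W-⊕p v with mem V v in v∈V
  ... | false rewrite mem-⊕ʳ V v p∈V | v∈V = refl
  ... | true  rewrite closed V v p v∈V p∈V | χ-isCharacter v p v∈V p∈V | χ-p with χ v
  ...   | true  = refl
  ...   | false = refl

  mem-W-⊕· : ∀ v e → mem W (v ⊕ e · p) ≡ mem V v ∧ not (χ v xor e)
  mem-W-⊕· v false = cong₂ (λ u b → mem V u ∧ not b) (⊕-identityʳ v)
                           (trans (cong χ (⊕-identityʳ v)) (sym (xor-identityʳ (χ v))))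
  mem-W-⊕· v true  = trans (mem-W-⊕p v) (cong (mem V v ∧_) (not-xor-true (χ v)))
    where
    not-xor-true : ∀ x → x ≡ not (x xor true)
    not-xor-true true  = refl
    not-xor-true false = refl

  mem-W-coset : ∀ y b e → mem W (y ⊕ (b ⊕ e · p)) ≡ mem V (y ⊕ b) ∧ not (χ (y ⊕ b) xor e)
  mem-W-coset y b e = trans (cong (mem W) (sym (⊕-assoc y b (e · p)))) (mem-W-⊕· (y ⊕ b) e)

  ∑-cosets-∧ : ∀ y b s → ∑ bools (λ e → 𝟙 (mem W (y ⊕ (b ⊕ e · p)) ∧ s)) ≡ 𝟙 (mem V (y ⊕ b) ∧ s)
  ∑-cosets-∧ y b s rewrite mem-W-coset y b false | mem-W-coset y b true
    with mem V (y ⊕ b) | χ (y ⊕ b) | s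
  ... | false | _     | _     = refl
  ... | true  | true  | true  = refl
  ... | true  | true  | false = refl
  ... | true  | false | true  = refl
  ... | true  | false | false = refl

  ∑-cosets : ∀ y b → ∑ bools (λ e → 𝟙 (mem W (y ⊕ (b ⊕ e · p)))) ≡ 𝟙 (mem V (y ⊕ b))
  ∑-cosets y b = begin
    ∑ bools (λ e → 𝟙 (mem W (y ⊕ (b ⊕ e · p))))
      ≡⟨ ∑-cong bools (λ e → cong 𝟙 (∧-identityʳ (mem W (y ⊕ (b ⊕ e · p))))) ⟨
    ∑ bools (λ e → 𝟙 (mem W (y ⊕ (b ⊕ e · p)) ∧ true))
      ≡⟨ ∑-cosets-∧ y b true ⟩
    𝟙 (mem V (y ⊕ b) ∧ true)
      ≡⟨ cong 𝟙 (∧-identityʳ (mem V (y ⊕ b))) ⟩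
    𝟙 (mem V (y ⊕ b))
      ∎

  sign-cosets : ∀ y b s → (if mem V (y ⊕ b) ∧ s then sign (χ (y ⊕ b)) else + 0)
                        ≡ + 𝟙 (mem W (y ⊕ (b ⊕ false · p)) ∧ s) ℤ.- + 𝟙 (mem W (y ⊕ (b ⊕ true · p)) ∧ s)
  sign-cosets y b s rewrite mem-W-coset y b false | mem-W-coset y b true
    with mem V (y ⊕ b) | χ (y ⊕ b) | s
  ... | false | _     | _     = refl
  ... | true  | true  | true  = refl
  ... | true  | true  | false = refl
  ... | true  | false | true  = refl
  ... | true  | false | false = refl

inSupp≡== : ∀ {n} (x y z : F2^ n) → inSupp (x , y , z) ≡ (z == x ⊕ y)
inSupp≡== []          []          []          = refl
inSupp≡== (false ∷ x) (false ∷ y) (false ∷ z) = inSupp≡== x y z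
inSupp≡== (false ∷ x) (false ∷ y) (true ∷ z)  = refl
inSupp≡== (false ∷ x) (true ∷ y)  (false ∷ z) = refl
inSupp≡== (false ∷ x) (true ∷ y)  (true ∷ z)  = inSupp≡== x y z
inSupp≡== (true ∷ x)  (false ∷ y) (false ∷ z) = refl
inSupp≡== (true ∷ x)  (false ∷ y) (true ∷ z)  = inSupp≡== x y z
inSupp≡== (true ∷ x)  (true ∷ y)  (false ∷ z) = inSupp≡== x y z
inSupp≡== (true ∷ x)  (true ∷ y)  (true ∷ z)  = refl

∑-allTriples : ∀ n (f : Triple n → ℕ) →
  ∑ (allTriples n) f ≡ ∑ (allVecs n) (λ x → ∑ (allVecs n) (λ y → ∑ (allVecs n) (λ z → f (x , y , z))))
∑-allTriples n f = trans (∑-concatMap (λ x → concatMap (triples x) (allVecs n)) (allVecs n) f)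
  (∑-cong (allVecs n) (λ x → trans (∑-concatMap (triples x) (allVecs n) f)
                                  (∑-cong (allVecs n) (λ y → ∑-map (λ z → x , y , z) (allVecs n) f))))
  where
  triples : F2^ n → F2^ n → List (Triple n)
  triples x y = map (λ z → x , y , z) (allVecs n)

count-support : ∀ n (Q : Triple n → Bool) →
  count (λ x → inSupp x ∧ Q x) (allTriples n) ≡ ∑ (allVecs n) (λ x → ∑ (allVecs n) (λ y → 𝟙 (Q (x , y , x ⊕ y))))
count-support n Q = begin
  count (λ x → inSupp x ∧ Q x) (allTriples n)
    ≡⟨ count≡∑𝟙 (λ x → inSupp x ∧ Q x) (allTriples n) ⟩
  ∑ (allTriples n) (λ x → 𝟙 (inSupp x ∧ Q x))
    ≡⟨ ∑-allTriples n (λ x → 𝟙 (inSupp x ∧ Q x)) ⟩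
  ∑ xs (λ x → ∑ xs (λ y → ∑ xs (λ z → 𝟙 (inSupp (x , y , z) ∧ Q (x , y , z)))))
    ≡⟨ ∑-cong xs (λ x → ∑-cong xs (λ y → trans (∑-cong xs (pointwise x y))
                                               (∑-allVecs-point n (x ⊕ y) (λ z → 𝟙 (Q (x , y , z)))))) ⟩
  ∑ xs (λ x → ∑ xs (λ y → 𝟙 (Q (x , y , x ⊕ y))))
    ∎
  where
  xs = allVecs n
  pointwise : ∀ x y z → 𝟙 (inSupp (x , y , z) ∧ Q (x , y , z)) ≡ (if z == x ⊕ y then 𝟙 (Q (x , y , z)) else 0)
  pointwise x y z rewrite inSupp≡== x y z with z == x ⊕ y
  ... | true  = refl
  ... | false = refl

size : ∀ {n} → Subspace n → ℕ
size {n} V = ∑ (allVecs n) (λ x → 𝟙 (mem V x))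

size-translate : ∀ {n} (V : Subspace n) a → ∑ (allVecs n) (λ x → 𝟙 (mem V (x ⊕ a))) ≡ size V
size-translate {n} V a = ∑-allVecs-translate n a (λ x → 𝟙 (mem V x))

⊕-regroup : ∀ {n} (x y a₁ a₂ a₃ : F2^ n) → x ⊕ y ⊕ a₃ ≡ ((x ⊕ a₁) ⊕ (y ⊕ a₂)) ⊕ (a₁ ⊕ a₂ ⊕ a₃)
⊕-regroup x y a₁ a₂ a₃ = sym (begin
  ((x ⊕ a₁) ⊕ (y ⊕ a₂)) ⊕ (a₁₂ ⊕ a₃)  ≡⟨ cong (_⊕ (a₁₂ ⊕ a₃)) (⊕-interchange x a₁ y a₂) ⟩
  ((x ⊕ y) ⊕ a₁₂) ⊕ (a₁₂ ⊕ a₃)        ≡⟨ ⊕-assoc (x ⊕ y) a₁₂ (a₁₂ ⊕ a₃) ⟩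
  (x ⊕ y) ⊕ (a₁₂ ⊕ (a₁₂ ⊕ a₃))        ≡⟨ cong ((x ⊕ y) ⊕_) (sym (⊕-assoc a₁₂ a₁₂ a₃)) ⟩
  (x ⊕ y) ⊕ ((a₁₂ ⊕ a₁₂) ⊕ a₃)        ≡⟨ cong (λ v → (x ⊕ y) ⊕ (v ⊕ a₃)) (⊕-self a₁₂) ⟩
  (x ⊕ y) ⊕ (0v ⊕ a₃)                 ≡⟨ cong ((x ⊕ y) ⊕_) (⊕-identityˡ a₃) ⟩
  (x ⊕ y) ⊕ a₃                        ∎)
  where
  a₁₂ = a₁ ⊕ a₂

mass : ∀ {n} → AffPart n → ℕ
mass {n} π = count (λ x → inSupp x ∧ inPart π x) (allTriples n)

mass-affPart : ∀ {n} (V : Subspace n) a₁ a₂ a₃ →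
               mass (affPart (a₁ , a₂ , a₃) V) ≡ 𝟙 (mem V (a₁ ⊕ a₂ ⊕ a₃)) ℕ.* (size V ℕ.* size V)
mass-affPart {n} V a₁ a₂ a₃ = begin
  mass (affPart (a₁ , a₂ , a₃) V)
    ≡⟨ count-support n (inPart (affPart (a₁ , a₂ , a₃) V)) ⟩
  ∑ xs (λ x → ∑ xs (λ y → 𝟙 (mem V (x ⊕ a₁) ∧ mem V (y ⊕ a₂) ∧ mem V (x ⊕ y ⊕ a₃))))
    ≡⟨ ∑-cong xs (λ x → ∑-cong xs (pointwise x)) ⟩
  ∑ xs (λ x → ∑ xs (λ y → m₁ x ℕ.* 𝟙 (mem V u) ℕ.* 𝟙 (mem V (y ⊕ a₂))))
    ≡⟨ ∑-cong xs (λ x → trans (∑-*ˡ xs (m₁ x ℕ.* 𝟙 (mem V u)) (λ y → 𝟙 (mem V (y ⊕ a₂))))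
                             (cong (m₁ x ℕ.* 𝟙 (mem V u) ℕ.*_) (size-translate V a₂))) ⟩
  ∑ xs (λ x → m₁ x ℕ.* 𝟙 (mem V u) ℕ.* size V)
    ≡⟨ ∑-*ʳ xs (size V) (λ x → m₁ x ℕ.* 𝟙 (mem V u)) ⟩
  ∑ xs (λ x → m₁ x ℕ.* 𝟙 (mem V u)) ℕ.* size V
    ≡⟨ cong (ℕ._* size V) (trans (∑-*ʳ xs (𝟙 (mem V u)) m₁) (cong (ℕ._* 𝟙 (mem V u)) (size-translate V a₁))) ⟩
  size V ℕ.* 𝟙 (mem V u) ℕ.* size V
    ≡⟨ rearrange (size V) (𝟙 (mem V u)) ⟩
  𝟙 (mem V u) ℕ.* (size V ℕ.* size V)
    ∎
  where
  xs = allVecs n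
  u  = a₁ ⊕ a₂ ⊕ a₃
  m₁ : F2^ n → ℕ
  m₁ x = 𝟙 (mem V (x ⊕ a₁))
  rearrange : ∀ s m → s ℕ.* m ℕ.* s ≡ m ℕ.* (s ℕ.* s)
  rearrange = solve-∀
  pointwise : ∀ x y → 𝟙 (mem V (x ⊕ a₁) ∧ mem V (y ⊕ a₂) ∧ mem V (x ⊕ y ⊕ a₃))
                    ≡ m₁ x ℕ.* 𝟙 (mem V u) ℕ.* 𝟙 (mem V (y ⊕ a₂))
  pointwise x y with mem V (x ⊕ a₁) in x∈ | mem V (y ⊕ a₂) in y∈
  ... | false | _     = refl
  ... | true  | false = sym (ℕₚ.*-zeroʳ (1 ℕ.* 𝟙 (mem V u)))
  ... | true  | true  rewrite ⊕-regroup x y a₁ a₂ a₃ | mem-⊕ˡ V u (closed V _ _ x∈ y∈) with mem V u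
  ...   | true  = refl
  ...   | false = refl

countIn : ∀ {n} → Subspace n → F2^ n → (F2^ n → Bool) → ℕ
countIn {n} V a S = ∑ (allVecs n) (λ x → 𝟙 (mem V (x ⊕ a) ∧ S x))

countIn≤size : ∀ {n} (V : Subspace n) a S → countIn V a S ℕ.≤ size V
countIn≤size {n} V a S = subst (countIn V a S ℕ.≤_) (size-translate V a) (∑-mono (allVecs n) pointwise)
  where
  pointwise : ∀ x → 𝟙 (mem V (x ⊕ a) ∧ S x) ℕ.≤ 𝟙 (mem V (x ⊕ a))
  pointwise x with mem V (x ⊕ a) | S x
  ... | true  | true  = ℕₚ.≤-refl
  ... | true  | false = ℕ.z≤n
  ... | false | _     = ℕ.z≤n

sq : ℕ → ℕ
sq x = x ℕ.* x

-- N times the energy ∑_π 𝒫(π) ∑ᵢ (density of Eᵢ in πᵢ)², where N is the size of the support of 𝒫.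
energy : ∀ {n} → (Fin 3 → F2^ n → Bool) → AffPart n → ℕ
energy E (affPart (a₁ , a₂ , a₃) V) =
  𝟙 (mem V (a₁ ⊕ a₂ ⊕ a₃))
    ℕ.* (sq (countIn V a₁ (E fz)) ℕ.+ sq (countIn V a₂ (E (fs fz))) ℕ.+ sq (countIn V a₃ (E (fs (fs fz)))))

energy≤3*mass : ∀ {n} (E : Fin 3 → F2^ n → Bool) π → energy E π ℕ.≤ 3 ℕ.* mass π
energy≤3*mass E (affPart (a₁ , a₂ , a₃) V) rewrite mass-affPart V a₁ a₂ a₃ =
  ℕₚ.≤-trans (ℕₚ.*-monoʳ-≤ m (ℕₚ.+-mono-≤ (ℕₚ.+-mono-≤ (sq-mono (countIn≤size V a₁ (E fz)))
                                                         (sq-mono (countIn≤size V a₂ (E (fs fz)))))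
                                           (sq-mono (countIn≤size V a₃ (E (fs (fs fz)))))))
             (ℕₚ.≤-reflexive (three-squares m (size V)))
  where
  m = 𝟙 (mem V (a₁ ⊕ a₂ ⊕ a₃))
  sq-mono : ∀ {a b} → a ℕ.≤ b → sq a ℕ.≤ sq b
  sq-mono a≤b = ℕₚ.*-mono-≤ a≤b a≤b
  three-squares : ∀ m s → m ℕ.* (s ℕ.* s ℕ.+ s ℕ.* s ℕ.+ s ℕ.* s) ≡ 3 ℕ.* (m ℕ.* (s ℕ.* s))
  three-squares = solve-∀

record Cell (n : ℕ) : Set where
  constructor cell
  field
    origin  : Triple n
    space   : Subspace n
    dim     : ℕ
    basis   : Vec (F2^ n) dim
    isBasis : IsBasis space basis
open Cell

cellPart : ∀ {n} → Cell n → AffPart n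
cellPart C = affPart (origin C) (space C)

Covers : ∀ {n} → List (Cell n) → Set
Covers {n} L = ∀ (x : Triple n) → ∑ L (λ C → 𝟙 (inPart (cellPart C) x)) ≡ 1

codim-suc : ∀ n k → n ∸ k ℕ.≤ suc (n ∸ suc k)
codim-suc zero    zero    = ℕ.z≤n
codim-suc zero    (suc k) = ℕ.z≤n
codim-suc (suc n) zero    = ℕₚ.≤-refl
codim-suc (suc n) (suc k) = codim-suc n k

module Children {n k : ℕ} (V : Subspace n) (B : Vec (F2^ n) (suc k)) (isB : IsBasis V B)
                (c : F2^ (suc k)) (nz : nonzero c ≡ true) where
  open Cut V B isB c nz public

  child : Triple n → Bool × Bool × Bool → Cell n
  child (a₁ , a₂ , a₃) (e₁ , e₂ , e₃) = cell (a₁ ⊕ e₁ · p , a₂ ⊕ e₂ · p , a₃ ⊕ e₃ · p) W k basisW isBasisW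

  children : Triple n → List (Cell n)
  children a = map (child a) signs³

  children-cover : ∀ a x → ∑ (children a) (λ C → 𝟙 (inPart (cellPart C) x)) ≡ 𝟙 (inPart (affPart a V) x)
  children-cover a@(a₁ , a₂ , a₃) x@(x₁ , x₂ , x₃) = begin
    ∑ (children a) (λ C → 𝟙 (inPart (cellPart C) x))
      ≡⟨ ∑-map (child a) signs³ (λ C → 𝟙 (inPart (cellPart C) x)) ⟩
    ∑ signs³ (λ e → 𝟙 (inPart (cellPart (child a e)) x))
      ≡⟨ ∑-cong signs³ (λ (e₁ , e₂ , e₃) →
           trans (𝟙-∧ (m₁ e₁) _) (cong (in₁ e₁ ℕ.*_) (𝟙-∧ (m₂ e₂) (m₃ e₃)))) ⟩
    ∑ signs³ (λ (e₁ , e₂ , e₃) → in₁ e₁ ℕ.* (in₂ e₂ ℕ.* in₃ e₃))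
      ≡⟨ ∑-signs³-product in₁ in₂ in₃ ⟩
    ∑ bools in₁ ℕ.* (∑ bools in₂ ℕ.* ∑ bools in₃)
      ≡⟨ cong₂ ℕ._*_ (∑-cosets x₁ a₁) (cong₂ ℕ._*_ (∑-cosets x₂ a₂) (∑-cosets x₃ a₃)) ⟩
    𝟙 (mem V (x₁ ⊕ a₁)) ℕ.* (𝟙 (mem V (x₂ ⊕ a₂)) ℕ.* 𝟙 (mem V (x₃ ⊕ a₃)))
      ≡⟨ trans (𝟙-∧ (mem V (x₁ ⊕ a₁)) _)
               (cong (𝟙 (mem V (x₁ ⊕ a₁)) ℕ.*_) (𝟙-∧ (mem V (x₂ ⊕ a₂)) (mem V (x₃ ⊕ a₃)))) ⟨
    𝟙 (inPart (affPart a V) x)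
      ∎
    where
    m₁ m₂ m₃ : Bool → Bool
    m₁ e = mem W (x₁ ⊕ (a₁ ⊕ e · p))
    m₂ e = mem W (x₂ ⊕ (a₂ ⊕ e · p))
    m₃ e = mem W (x₃ ⊕ (a₃ ⊕ e · p))
    in₁ in₂ in₃ : Bool → ℕ
    in₁ e = 𝟙 (m₁ e)
    in₂ e = 𝟙 (m₂ e)
    in₃ e = 𝟙 (m₃ e)

  halfCount : F2^ n → (F2^ n → Bool) → Bool → ℕ
  halfCount a S e = countIn W (a ⊕ e · p) S

  countIn-cut : ∀ a S → countIn V a S ≡ ∑ bools (halfCount a S)
  countIn-cut a S = begin
    countIn V a S
      ≡⟨ ∑-cong (allVecs n) (λ x → ∑-cosets-∧ x a (S x)) ⟨
    ∑ (allVecs n) (λ x → ∑ bools (λ e → 𝟙 (mem W (x ⊕ (a ⊕ e · p)) ∧ S x)))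
      ≡⟨ ∑-swap (allVecs n) bools (λ x e → 𝟙 (mem W (x ⊕ (a ⊕ e · p)) ∧ S x)) ⟩
    ∑ bools (halfCount a S)
      ∎

  fourier-numerator-cut : ∀ a S →
    foldr ℤ._+_ (+ 0) (map (λ x → if mem V (x ⊕ a) ∧ S x then sign (χ (x ⊕ a)) else + 0) (allVecs n))
    ≡ + halfCount a S false ℤ.- + halfCount a S true
  fourier-numerator-cut a S =
    trans (cong (foldr ℤ._+_ (+ 0)) (map-cong (λ x → sign-cosets x a (S x)) (allVecs n)))
          (foldr-+-difference (allVecs n) _ _)

  origin-sum : ∀ a₁ a₂ a₃ e₁ e₂ e₃ → (a₁ ⊕ e₁ · p) ⊕ (a₂ ⊕ e₂ · p) ⊕ (a₃ ⊕ e₃ · p)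
                                       ≡ (a₁ ⊕ a₂ ⊕ a₃) ⊕ ((e₁ xor e₂) xor e₃) · p
  origin-sum a₁ a₂ a₃ e₁ e₂ e₃ = begin
    ((a₁ ⊕ e₁ · p) ⊕ (a₂ ⊕ e₂ · p)) ⊕ (a₃ ⊕ e₃ · p)
      ≡⟨ cong (_⊕ (a₃ ⊕ e₃ · p)) (⊕-interchange a₁ (e₁ · p) a₂ (e₂ · p)) ⟩
    ((a₁ ⊕ a₂) ⊕ (e₁ · p ⊕ e₂ · p)) ⊕ (a₃ ⊕ e₃ · p)
      ≡⟨ ⊕-interchange (a₁ ⊕ a₂) (e₁ · p ⊕ e₂ · p) a₃ (e₃ · p) ⟩
    (a₁ ⊕ a₂ ⊕ a₃) ⊕ ((e₁ · p ⊕ e₂ · p) ⊕ e₃ · p)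
      ≡⟨ cong ((a₁ ⊕ a₂ ⊕ a₃) ⊕_) (trans (·-xor (e₁ xor e₂) e₃ p) (cong (_⊕ e₃ · p) (·-xor e₁ e₂ p))) ⟨
    (a₁ ⊕ a₂ ⊕ a₃) ⊕ ((e₁ xor e₂) xor e₃) · p
      ∎

  module _ (E : Fin 3 → F2^ n → Bool) (a₁ a₂ a₃ : F2^ n) where

    private
      u = a₁ ⊕ a₂ ⊕ a₃
      h₁ h₂ h₃ : Bool → ℕ
      h₁ = halfCount a₁ (E fz)
      h₂ = halfCount a₂ (E (fs fz))
      h₃ = halfCount a₃ (E (fs (fs fz)))

    energy-parent : energy E (affPart (a₁ , a₂ , a₃) V)
                    ≡ 𝟙 (mem V u) ℕ.* (sq (∑ bools h₁) ℕ.+ sq (∑ bools h₂) ℕ.+ sq (∑ bools h₃))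
    energy-parent rewrite countIn-cut a₁ (E fz) | countIn-cut a₂ (E (fs fz)) | countIn-cut a₃ (E (fs (fs fz))) = refl

    energy-children : ∑ (children (a₁ , a₂ , a₃)) (λ C → energy E (cellPart C))
                      ≡ 𝟙 (mem V u) ℕ.* (2 ℕ.* (∑ bools (sq ∘ h₁) ℕ.+ ∑ bools (sq ∘ h₂) ℕ.+ ∑ bools (sq ∘ h₃)))
    energy-children = begin
      ∑ (children (a₁ , a₂ , a₃)) (λ C → energy E (cellPart C))
        ≡⟨ ∑-map (child (a₁ , a₂ , a₃)) signs³ (λ C → energy E (cellPart C)) ⟩
      ∑ signs³ (λ e → energy E (cellPart (child (a₁ , a₂ , a₃) e)))
        ≡⟨ ∑-cong signs³ pointwise ⟩
      ∑ signs³ (λ (e₁ , e₂ , e₃) → 𝟙 (mem V u) ℕ.* (parity e₁ e₂ e₃ ℕ.* squares e₁ e₂ e₃))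
        ≡⟨ ∑-*ˡ signs³ (𝟙 (mem V u)) (λ (e₁ , e₂ , e₃) → parity e₁ e₂ e₃ ℕ.* squares e₁ e₂ e₃) ⟩
      𝟙 (mem V u) ℕ.* ∑ signs³ (λ (e₁ , e₂ , e₃) → parity e₁ e₂ e₃ ℕ.* squares e₁ e₂ e₃)
        ≡⟨ cong (𝟙 (mem V u) ℕ.*_) (parity-sum (χ u) (sq ∘ h₁) (sq ∘ h₂) (sq ∘ h₃)) ⟩
      𝟙 (mem V u) ℕ.* (2 ℕ.* (∑ bools (sq ∘ h₁) ℕ.+ ∑ bools (sq ∘ h₂) ℕ.+ ∑ bools (sq ∘ h₃)))
        ∎
      where
      parity squares : Bool → Bool → Bool → ℕ
      parity e₁ e₂ e₃  = 𝟙 (not (χ u xor ((e₁ xor e₂) xor e₃)))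
      squares e₁ e₂ e₃ = sq (h₁ e₁) ℕ.+ sq (h₂ e₂) ℕ.+ sq (h₃ e₃)
      pointwise : ∀ ((e₁ , e₂ , e₃) : Bool × Bool × Bool) →
                  energy E (cellPart (child (a₁ , a₂ , a₃) (e₁ , e₂ , e₃)))
                  ≡ 𝟙 (mem V u) ℕ.* (parity e₁ e₂ e₃ ℕ.* squares e₁ e₂ e₃)
      pointwise (e₁ , e₂ , e₃) = begin
        𝟙 (mem W ((a₁ ⊕ e₁ · p) ⊕ (a₂ ⊕ e₂ · p) ⊕ (a₃ ⊕ e₃ · p))) ℕ.* squares e₁ e₂ e₃
          ≡⟨ cong (λ v → 𝟙 (mem W v) ℕ.* squares e₁ e₂ e₃) (origin-sum a₁ a₂ a₃ e₁ e₂ e₃) ⟩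
        𝟙 (mem W (u ⊕ ((e₁ xor e₂) xor e₃) · p)) ℕ.* squares e₁ e₂ e₃
          ≡⟨ cong (λ b → 𝟙 b ℕ.* squares e₁ e₂ e₃) (mem-W-⊕· u ((e₁ xor e₂) xor e₃)) ⟩
        𝟙 (mem V u ∧ not (χ u xor ((e₁ xor e₂) xor e₃))) ℕ.* squares e₁ e₂ e₃
          ≡⟨ cong (ℕ._* squares e₁ e₂ e₃) (𝟙-∧ (mem V u) _) ⟩
        𝟙 (mem V u) ℕ.* parity e₁ e₂ e₃ ℕ.* squares e₁ e₂ e₃
          ≡⟨ ℕₚ.*-assoc (𝟙 (mem V u)) (parity e₁ e₂ e₃) (squares e₁ e₂ e₃) ⟩
        𝟙 (mem V u) ℕ.* (parity e₁ e₂ e₃ ℕ.* squares e₁ e₂ e₃)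
          ∎

ℤ→ℚ≡fromℤ : ∀ z → ℤ→ℚ z ≡ fromℤ z
ℤ→ℚ≡fromℤ (+ n)      = ℚₚ.normalize-coprime _
ℤ→ℚ≡fromℤ -[1+ n ]   = cong -_ (ℚₚ.normalize-coprime (Coprime.sym (Coprime.1-coprimeTo (suc n))))

fromℤ-+ : ∀ a b → fromℤ (a ℤ.+ b) ≡ fromℤ a + fromℤ b
fromℤ-+ a b = sym (trans (cong₂ (λ x y → ℤ→ℚ (x ℤ.+ y)) (ℤₚ.*-identityʳ a) (ℤₚ.*-identityʳ b))
                         (ℤ→ℚ≡fromℤ (a ℤ.+ b)))

fromℤ-* : ∀ a b → fromℤ (a ℤ.* b) ≡ fromℤ a * fromℤ b
fromℤ-* a b = sym (ℤ→ℚ≡fromℤ (a ℤ.* b))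

fromℤ-neg : ∀ a → fromℤ (ℤ.- a) ≡ - fromℤ a
fromℤ-neg (+ zero)  = refl
fromℤ-neg (+ suc n) = refl
fromℤ-neg -[1+ n ]  = refl

fromℤ-mono-≤ : ∀ {a b} → a ℤ.≤ b → fromℤ a ≤ fromℤ b
fromℤ-mono-≤ {a} {b} a≤b = ℚ.*≤* (subst₂ ℤ._≤_ (sym (ℤₚ.*-identityʳ a)) (sym (ℤₚ.*-identityʳ b)) a≤b)

ℕ→ℚ≡fromℤ : ∀ n → ℕ→ℚ n ≡ fromℤ (+ n)
ℕ→ℚ≡fromℤ n = ℤ→ℚ≡fromℤ (+ n)

ℕ→ℚ-+ : ∀ a b → ℕ→ℚ (a ℕ.+ b) ≡ ℕ→ℚ a + ℕ→ℚ b
ℕ→ℚ-+ a b = begin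
  ℕ→ℚ (a ℕ.+ b)           ≡⟨ ℕ→ℚ≡fromℤ (a ℕ.+ b) ⟩
  fromℤ (+ (a ℕ.+ b))     ≡⟨ cong fromℤ (ℤₚ.pos-+ a b) ⟩
  fromℤ (+ a ℤ.+ + b)     ≡⟨ fromℤ-+ (+ a) (+ b) ⟩
  fromℤ (+ a) + fromℤ (+ b) ≡⟨ cong₂ _+_ (ℕ→ℚ≡fromℤ a) (ℕ→ℚ≡fromℤ b) ⟨
  ℕ→ℚ a + ℕ→ℚ b           ∎

ℕ→ℚ-* : ∀ a b → ℕ→ℚ (a ℕ.* b) ≡ ℕ→ℚ a * ℕ→ℚ b
ℕ→ℚ-* a b = begin
  ℕ→ℚ (a ℕ.* b)           ≡⟨ ℕ→ℚ≡fromℤ (a ℕ.* b) ⟩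
  fromℤ (+ (a ℕ.* b))     ≡⟨ cong fromℤ (ℤₚ.pos-* a b) ⟩
  fromℤ (+ a ℤ.* + b)     ≡⟨ fromℤ-* (+ a) (+ b) ⟩
  fromℤ (+ a) * fromℤ (+ b) ≡⟨ cong₂ _*_ (ℕ→ℚ≡fromℤ a) (ℕ→ℚ≡fromℤ b) ⟨
  ℕ→ℚ a * ℕ→ℚ b           ∎

ℕ→ℚ-mono-≤ : ∀ {a b} → a ℕ.≤ b → ℕ→ℚ a ≤ ℕ→ℚ b
ℕ→ℚ-mono-≤ {a} {b} a≤b =
  subst₂ _≤_ (sym (ℕ→ℚ≡fromℤ a)) (sym (ℕ→ℚ≡fromℤ b)) (fromℤ-mono-≤ (ℤ.+≤+ a≤b))

ℕ→ℚ-nonNeg : ∀ a → 0ℚ ≤ ℕ→ℚ a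
ℕ→ℚ-nonNeg a = ℕ→ℚ-mono-≤ {0} {a} ℕ.z≤n

ℤ→ℚ-* : ∀ a b → ℤ→ℚ (a ℤ.* b) ≡ ℤ→ℚ a * ℤ→ℚ b
ℤ→ℚ-* a b = trans (ℤ→ℚ≡fromℤ _) (trans (fromℤ-* a b) (sym (cong₂ _*_ (ℤ→ℚ≡fromℤ a) (ℤ→ℚ≡fromℤ b))))

ℤ→ℚ-difference : ∀ a b → ℤ→ℚ (+ a ℤ.- + b) ≡ ℕ→ℚ a - ℕ→ℚ b
ℤ→ℚ-difference a b = begin
  ℤ→ℚ (+ a ℤ.- + b)                ≡⟨ ℤ→ℚ≡fromℤ _ ⟩
  fromℤ (+ a ℤ.+ ℤ.- + b)          ≡⟨ fromℤ-+ (+ a) (ℤ.- + b) ⟩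
  fromℤ (+ a) + fromℤ (ℤ.- + b)    ≡⟨ cong (λ y → fromℤ (+ a) + y) (fromℤ-neg (+ b)) ⟩
  fromℤ (+ a) - fromℤ (+ b)        ≡⟨ cong₂ _-_ (ℕ→ℚ≡fromℤ a) (ℕ→ℚ≡fromℤ b) ⟨
  ℕ→ℚ a - ℕ→ℚ b                    ∎

/?-*-cancel : ∀ p r → r ≢ 0ℚ → (p /? r) * r ≡ p
/?-*-cancel p r r≢0 with r ℚₚ.≟ 0ℚ
... | yes r≡0 = ⊥-elim (r≢0 r≡0)
... | no  r≢0′ = trans (ℚₚ.*-assoc p (1/ r) r) (trans (cong (p *_) (ℚₚ.*-inverseˡ r)) (ℚₚ.*-identityʳ p))
  where instance _ = ℚ.≢-nonZero r≢0′

/?-zero : ∀ p r → r ≡ 0ℚ → p /? r ≡ 0ℚ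
/?-zero p r r≡0 with r ℚₚ.≟ 0ℚ
... | yes _   = refl
... | no  r≢0 = ⊥-elim (r≢0 r≡0)

/?-nonNeg : ∀ p q → 0ℚ ≤ p → 0ℚ < q → 0ℚ ≤ p /? q
/?-nonNeg p q 0≤p 0<q = ℚₚ.*-cancelʳ-≤-pos q {{ℚ.positive 0<q}}
  (subst₂ _≤_ (sym (ℚₚ.*-zeroˡ q)) (sym (/?-*-cancel p q (λ q≡0 → ℚₚ.<-irrefl (sym q≡0) 0<q))) 0≤p)

/?<⇒<* : ∀ p q r → 0ℚ < q → p /? q < r → p < r * q
/?<⇒<* p q r 0<q p/q<r = subst (_< r * q) (/?-*-cancel p q (λ q≡0 → ℚₚ.<-irrefl (sym q≡0) 0<q))
                               (ℚₚ.*-monoˡ-<-pos q {{ℚ.positive 0<q}} p/q<r)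

nonNeg∧≢0⇒pos : ∀ x → 0ℚ ≤ x → x ≢ 0ℚ → 0ℚ < x
nonNeg∧≢0⇒pos x 0≤x x≢0 with 0ℚ ℚₚ.<? x
... | yes 0<x = 0<x
... | no  0≮x = ⊥-elim (x≢0 (ℚₚ.≤-antisym (ℚₚ.≮⇒≥ 0≮x) 0≤x))

*-pos : ∀ {x y} → 0ℚ < x → 0ℚ < y → 0ℚ < x * y
*-pos {x} {y} 0<x 0<y = subst (_< x * y) (ℚₚ.*-zeroˡ y) (ℚₚ.*-monoˡ-<-pos y {{ℚ.positive 0<y}} 0<x)

square-mono-≤ : ∀ {a b} → 0ℚ ≤ a → a ≤ b → a * a ≤ b * b
square-mono-≤ {a} {b} 0≤a a≤b = ℚₚ.≤-trans (ℚₚ.*-monoˡ-≤-nonNeg a {{ℚ.nonNegative 0≤a}} a≤b)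
                                           (ℚₚ.*-monoʳ-≤-nonNeg b {{ℚ.nonNegative (ℚₚ.≤-trans 0≤a a≤b)}} a≤b)

∣x∣*∣x∣≡x*x : ∀ x → ∣ x ∣ * ∣ x ∣ ≡ x * x
∣x∣*∣x∣≡x*x x with ℚₚ.∣p∣≡p∨∣p∣≡-p x
... | inj₁ ∣x∣≡x  rewrite ∣x∣≡x  = refl
... | inj₂ ∣x∣≡-x rewrite ∣x∣≡-x = solve 1 (λ x → (:- x) :* (:- x) := x :* x) refl x

square-nonNeg : ∀ x → 0ℚ ≤ x * x
square-nonNeg x = subst (0ℚ ≤_) (∣x∣*∣x∣≡x*x x)
  (ℚₚ.≤-trans (ℚₚ.≤-reflexive (sym (ℚₚ.*-zeroˡ ∣ x ∣)))
              (ℚₚ.*-monoʳ-≤-nonNeg ∣ x ∣ {{ℚ.nonNegative (ℚₚ.0≤∣p∣ x)}} (ℚₚ.0≤∣p∣ x)))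

-- The junk value D /? 0 = 0 never exceeds δ > 0, so Z ≢ 0 in the interesting case.
ratio>⇒square≥ : ∀ (D : ℤ) (Z : ℕ) (δ : ℚ) → 0ℚ < δ → δ < ∣ ℤ→ℚ D /? ℕ→ℚ Z ∣ →
                 δ * δ * ℕ→ℚ (Z ℕ.* Z) ≤ ℤ→ℚ (D ℤ.* D)
ratio>⇒square≥ D Z δ 0<δ δ<∣r∣ = by-cases (ℕ→ℚ Z ℚₚ.≟ 0ℚ)
  where
  r = ℤ→ℚ D /? ℕ→ℚ Z
  ∣r∣Z≡∣D∣ : ℕ→ℚ Z ≢ 0ℚ → ∣ r ∣ * ℕ→ℚ Z ≡ ∣ ℤ→ℚ D ∣
  ∣r∣Z≡∣D∣ Z≢0 = begin
    ∣ r ∣ * ℕ→ℚ Z          ≡⟨ cong (∣ r ∣ *_) (ℚₚ.0≤p⇒∣p∣≡p (ℕ→ℚ-nonNeg Z)) ⟨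
    ∣ r ∣ * ∣ ℕ→ℚ Z ∣      ≡⟨ ℚₚ.∣p*q∣≡∣p∣*∣q∣ r (ℕ→ℚ Z) ⟨
    ∣ r * ℕ→ℚ Z ∣          ≡⟨ cong ∣_∣ (/?-*-cancel (ℤ→ℚ D) (ℕ→ℚ Z) Z≢0) ⟩
    ∣ ℤ→ℚ D ∣              ∎
  δ²Z² : δ * δ * ℕ→ℚ (Z ℕ.* Z) ≡ (δ * ℕ→ℚ Z) * (δ * ℕ→ℚ Z)
  δ²Z² = trans (cong (δ * δ *_) (ℕ→ℚ-* Z Z))
               (solve 2 (λ a b → a :* a :* (b :* b) := (a :* b) :* (a :* b)) refl δ (ℕ→ℚ Z))
  0≤δZ : 0ℚ ≤ δ * ℕ→ℚ Z
  0≤δZ = subst (_≤ δ * ℕ→ℚ Z) (ℚₚ.*-zeroˡ (ℕ→ℚ Z))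
               (ℚₚ.*-monoʳ-≤-nonNeg (ℕ→ℚ Z) {{ℚ.nonNegative (ℕ→ℚ-nonNeg Z)}} (ℚₚ.<⇒≤ 0<δ))
  by-cases : Dec (ℕ→ℚ Z ≡ 0ℚ) → δ * δ * ℕ→ℚ (Z ℕ.* Z) ≤ ℤ→ℚ (D ℤ.* D)
  by-cases (yes Z≡0) = ⊥-elim (ℚₚ.<-asym 0<δ (subst (δ <_) (cong ∣_∣ (/?-zero (ℤ→ℚ D) (ℕ→ℚ Z) Z≡0)) δ<∣r∣))
  by-cases (no  Z≢0) = subst₂ _≤_ (sym δ²Z²) (sym (trans (ℤ→ℚ-* D D) (sym (∣x∣*∣x∣≡x*x (ℤ→ℚ D)))))
    (square-mono-≤ 0≤δZ (subst (δ * ℕ→ℚ Z ≤_) (∣r∣Z≡∣D∣ Z≢0)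
      (ℚₚ.*-monoʳ-≤-nonNeg (ℕ→ℚ Z) {{ℚ.nonNegative (ℕ→ℚ-nonNeg Z)}} (ℚₚ.<⇒≤ δ<∣r∣))))

floor : ∀ (r : ℚ) → 0ℚ ≤ r → Σ ℕ λ K → ℕ→ℚ K ≤ r × r < ℕ→ℚ (suc K)
floor (mkℚ -[1+ a ] b _) (ℚ.*≤* ())
floor r@(mkℚ (+ a) b _) _ = K , K≤r , r<1+K
  where
  d = suc b
  K = a ℕ./ d
  K≤r : ℕ→ℚ K ≤ r
  K≤r = subst (_≤ r) (sym (ℕ→ℚ≡fromℤ K))
          (ℚ.*≤* (subst₂ ℤ._≤_ (ℤₚ.pos-* K d) (sym (ℤₚ.*-identityʳ (+ a))) (ℤ.+≤+ (m/n*n≤m a d))))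
  a<[1+K]d : a ℕ.< suc K ℕ.* d
  a<[1+K]d = subst (ℕ._< suc K ℕ.* d) (sym (m≡m%n+[m/n]*n a d)) (ℕₚ.+-monoˡ-< (K ℕ.* d) (m%n<n a d))
  r<1+K : r < ℕ→ℚ (suc K)
  r<1+K = subst (r <_) (sym (ℕ→ℚ≡fromℤ (suc K)))
            (ℚ.*<* (subst₂ ℤ._<_ (sym (ℤₚ.*-identityʳ (+ a))) (ℤₚ.pos-* (suc K) d) (ℤ.+<+ a<[1+K]d)))

-- The energy increment

ℕ→ℚ-+₃ : ∀ a b c → ℕ→ℚ (a ℕ.+ b ℕ.+ c) ≡ ℕ→ℚ a + ℕ→ℚ b + ℕ→ℚ c
ℕ→ℚ-+₃ a b c = trans (ℕ→ℚ-+ (a ℕ.+ b) c) (cong (_+ ℕ→ℚ c) (ℕ→ℚ-+ a b))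

ℕ→ℚ-∑bools : ∀ h → ℕ→ℚ (∑ bools h) ≡ ℕ→ℚ (h false) + ℕ→ℚ (h true)
ℕ→ℚ-∑bools h = trans (cong (λ t → ℕ→ℚ (h false ℕ.+ t)) (ℕₚ.+-identityʳ (h true))) (ℕ→ℚ-+ (h false) (h true))

total gap : (Bool → ℕ) → ℚ
total h = ℕ→ℚ (h false) + ℕ→ℚ (h true)
gap   h = ℕ→ℚ (h false) - ℕ→ℚ (h true)

ℕ→ℚ-sq-∑bools : ∀ h → ℕ→ℚ (sq (∑ bools h)) ≡ total h * total h
ℕ→ℚ-sq-∑bools h = trans (ℕ→ℚ-* (∑ bools h) (∑ bools h)) (cong (λ t → t * t) (ℕ→ℚ-∑bools h))

ℕ→ℚ-∑bools-sq : ∀ h → ℕ→ℚ (∑ bools (sq ∘ h))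
                      ≡ ℕ→ℚ (h false) * ℕ→ℚ (h false) + ℕ→ℚ (h true) * ℕ→ℚ (h true)
ℕ→ℚ-∑bools-sq h =
  trans (ℕ→ℚ-∑bools (sq ∘ h)) (cong₂ _+_ (ℕ→ℚ-* (h false) (h false)) (ℕ→ℚ-* (h true) (h true)))

term≤sum₃ : ∀ (f : Fin 3 → ℚ) → (∀ j → 0ℚ ≤ f j) → ∀ i → f i ≤ f fz + f (fs fz) + f (fs (fs fz))
term≤sum₃ f 0≤f fz           = subst (_≤ f fz + f (fs fz) + f (fs (fs fz)))
  (trans (ℚₚ.+-identityʳ (f fz + 0ℚ)) (ℚₚ.+-identityʳ (f fz)))
  (ℚₚ.+-mono-≤ (ℚₚ.+-mono-≤ (ℚₚ.≤-refl {f fz}) (0≤f (fs fz))) (0≤f (fs (fs fz))))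
term≤sum₃ f 0≤f (fs fz)      = subst (_≤ f fz + f (fs fz) + f (fs (fs fz)))
  (trans (ℚₚ.+-identityʳ (0ℚ + f (fs fz))) (ℚₚ.+-identityˡ (f (fs fz))))
  (ℚₚ.+-mono-≤ (ℚₚ.+-mono-≤ (0≤f fz) (ℚₚ.≤-refl {f (fs fz)})) (0≤f (fs (fs fz))))
term≤sum₃ f 0≤f (fs (fs fz)) = subst (_≤ f fz + f (fs fz) + f (fs (fs fz)))
  (ℚₚ.+-identityˡ (f (fs (fs fz))))
  (ℚₚ.+-mono-≤ (ℚₚ.+-mono-≤ (0≤f fz) (0≤f (fs fz))) (ℚₚ.≤-refl {f (fs (fs fz))}))

module _ {n k : ℕ} (V : Subspace n) (B : Vec (F2^ n) (suc k)) (isB : IsBasis V B)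
         (c : F2^ (suc k)) (nz : nonzero c ≡ true) where
  open Children V B isB c nz

  fourierCoeff-cut : ∀ a S →
    fourierCoeff V a S χ ≡ ℤ→ℚ (+ halfCount a S false ℤ.- + halfCount a S true) /? ℕ→ℚ (size V)
  fourierCoeff-cut a S = cong₂ (λ z m → ℤ→ℚ z /? ℕ→ℚ m) (fourier-numerator-cut a S)
    (trans (count≡∑𝟙 (λ x → mem V (x ⊕ a)) (allVecs n)) (size-translate V a))

  biased⇒gap : ∀ a S δ → 0ℚ < δ → δ < ∣ fourierCoeff V a S χ ∣ →
               δ * δ * ℕ→ℚ (size V ℕ.* size V) ≤ gap (halfCount a S) * gap (halfCount a S)
  biased⇒gap a S δ 0<δ biased = subst (δ * δ * ℕ→ℚ (size V ℕ.* size V) ≤_) D²≡gap²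
    (ratio>⇒square≥ D (size V) δ 0<δ (subst (λ r → δ < ∣ r ∣) (fourierCoeff-cut a S) biased))
    where
    D = + halfCount a S false ℤ.- + halfCount a S true
    D²≡gap² : ℤ→ℚ (D ℤ.* D) ≡ gap (halfCount a S) * gap (halfCount a S)
    D²≡gap² = trans (ℤ→ℚ-* D D) (cong (λ t → t * t) (ℤ→ℚ-difference (halfCount a S false) (halfCount a S true)))

  energy-increment : ∀ (E : Fin 3 → F2^ n → Bool) a δ → 0ℚ < δ → ∀ i →
    δ < ∣ fourierCoeff V (coord i a) (E i) χ ∣ →
    ℕ→ℚ (energy E (affPart a V)) + δ * δ * ℕ→ℚ (mass (affPart a V)) ≤ ℕ→ℚ (∑ (children a) (energy E ∘ cellPart))
  energy-increment E a@(a₁ , a₂ , a₃) δ 0<δ i biased =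
    subst₂ _≤_ (sym parent≡) (sym children≡)
      (ℚₚ.+-monoʳ-≤ (M * P) (subst (_≤ M * Q) (reassociate M δ Z²)
        (ℚₚ.*-monoˡ-≤-nonNeg M {{ℚ.nonNegative (ℕ→ℚ-nonNeg m)}}
          (ℚₚ.≤-trans (biased⇒gap (coord i a) (E i) δ 0<δ biased)
                      (term≤sum₃ (λ j → gap (h j) * gap (h j)) (λ j → square-nonNeg (gap (h j))) i)))))
    where
    h : Fin 3 → Bool → ℕ
    h j = halfCount (coord j a) (E j)
    m  = 𝟙 (mem V (a₁ ⊕ a₂ ⊕ a₃))
    M  = ℕ→ℚ m
    Z² = ℕ→ℚ (size V ℕ.* size V)
    P  = total (h fz) * total (h fz) + total (h (fs fz)) * total (h (fs fz))
         + total (h (fs (fs fz))) * total (h (fs (fs fz)))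
    Q  = gap (h fz) * gap (h fz) + gap (h (fs fz)) * gap (h (fs fz)) + gap (h (fs (fs fz))) * gap (h (fs (fs fz)))
    reassociate : ∀ M δ Z² → M * (δ * δ * Z²) ≡ δ * δ * (M * Z²)
    reassociate = solve 3 (λ M δ Z² → M :* (δ :* δ :* Z²) := δ :* δ :* (M :* Z²)) refl
    parallelogram : ∀ M x₁ y₁ x₂ y₂ x₃ y₃ →
      M * (ℕ→ℚ 2 * (x₁ * x₁ + y₁ * y₁ + (x₂ * x₂ + y₂ * y₂) + (x₃ * x₃ + y₃ * y₃)))
      ≡ M * ((x₁ + y₁) * (x₁ + y₁) + (x₂ + y₂) * (x₂ + y₂) + (x₃ + y₃) * (x₃ + y₃))
        + M * ((x₁ - y₁) * (x₁ - y₁) + (x₂ - y₂) * (x₂ - y₂) + (x₃ - y₃) * (x₃ - y₃))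
    parallelogram = solve 7 (λ M x₁ y₁ x₂ y₂ x₃ y₃ →
      M :* (con (ℕ→ℚ 2) :* (x₁ :* x₁ :+ y₁ :* y₁ :+ (x₂ :* x₂ :+ y₂ :* y₂) :+ (x₃ :* x₃ :+ y₃ :* y₃)))
      := M :* ((x₁ :+ y₁) :* (x₁ :+ y₁) :+ (x₂ :+ y₂) :* (x₂ :+ y₂) :+ (x₃ :+ y₃) :* (x₃ :+ y₃))
         :+ M :* ((x₁ :- y₁) :* (x₁ :- y₁) :+ (x₂ :- y₂) :* (x₂ :- y₂) :+ (x₃ :- y₃) :* (x₃ :- y₃))) refl
    parent≡ : ℕ→ℚ (energy E (affPart a V)) + δ * δ * ℕ→ℚ (mass (affPart a V)) ≡ M * P + δ * δ * (M * Z²)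
    parent≡ = cong₂ _+_
      (begin
        ℕ→ℚ (energy E (affPart a V))
          ≡⟨ cong ℕ→ℚ (energy-parent E a₁ a₂ a₃) ⟩
        ℕ→ℚ (m ℕ.* S)
          ≡⟨ ℕ→ℚ-* m S ⟩
        M * ℕ→ℚ S
          ≡⟨ cong (M *_) (trans (ℕ→ℚ-+₃ (sq (∑ bools (h fz))) (sq (∑ bools (h (fs fz)))) (sq (∑ bools (h (fs (fs fz))))))
               (cong₂ _+_ (cong₂ _+_ (ℕ→ℚ-sq-∑bools (h fz)) (ℕ→ℚ-sq-∑bools (h (fs fz))))
                          (ℕ→ℚ-sq-∑bools (h (fs (fs fz)))))) ⟩
        M * P
          ∎)
      (cong (δ * δ *_) (trans (cong ℕ→ℚ (mass-affPart V a₁ a₂ a₃)) (ℕ→ℚ-* m (size V ℕ.* size V))))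
      where
      S = sq (∑ bools (h fz)) ℕ.+ sq (∑ bools (h (fs fz))) ℕ.+ sq (∑ bools (h (fs (fs fz))))
    children≡ : ℕ→ℚ (∑ (children a) (energy E ∘ cellPart)) ≡ M * P + M * Q
    children≡ = begin
      ℕ→ℚ (∑ (children a) (energy E ∘ cellPart))
        ≡⟨ cong ℕ→ℚ (energy-children E a₁ a₂ a₃) ⟩
      ℕ→ℚ (m ℕ.* (2 ℕ.* T))
        ≡⟨ trans (ℕ→ℚ-* m (2 ℕ.* T)) (cong (M *_) (ℕ→ℚ-* 2 T)) ⟩
      M * (ℕ→ℚ 2 * ℕ→ℚ T)
        ≡⟨ cong (λ t → M * (ℕ→ℚ 2 * t))
             (trans (ℕ→ℚ-+₃ (∑ bools (sq ∘ h fz)) (∑ bools (sq ∘ h (fs fz))) (∑ bools (sq ∘ h (fs (fs fz)))))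
                    (cong₂ _+_ (cong₂ _+_ (ℕ→ℚ-∑bools-sq (h fz)) (ℕ→ℚ-∑bools-sq (h (fs fz))))
                               (ℕ→ℚ-∑bools-sq (h (fs (fs fz)))))) ⟩
      M * (ℕ→ℚ 2 * (X fz * X fz + Y fz * Y fz + (X (fs fz) * X (fs fz) + Y (fs fz) * Y (fs fz))
                    + (X (fs (fs fz)) * X (fs (fs fz)) + Y (fs (fs fz)) * Y (fs (fs fz)))))
        ≡⟨ parallelogram M (X fz) (Y fz) (X (fs fz)) (Y (fs fz)) (X (fs (fs fz))) (Y (fs (fs fz))) ⟩
      M * P + M * Q
        ∎
      where
      T = ∑ bools (sq ∘ h fz) ℕ.+ ∑ bools (sq ∘ h (fs fz)) ℕ.+ ∑ bools (sq ∘ h (fs (fs fz)))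
      X Y : Fin 3 → ℚ
      X j = ℕ→ℚ (h j false)
      Y j = ℕ→ℚ (h j true)

unique-index : ∀ {A : Set} (xs : List A) (p : A → Bool) → ∑ xs (λ a → 𝟙 (p a)) ≡ 1 →
  Σ (Fin (length xs)) λ j → p (lookup xs j) ≡ true × (∀ j′ → p (lookup xs j′) ≡ true → j′ ≡ j)
                          × (∀ (h : A → Bool) → ∑ xs (λ a → 𝟙 (p a) ℕ.* 𝟙 (h a)) ≡ 𝟙 (h (lookup xs j)))
unique-index {A} (x ∷ xs) p ∑≡1 with p x in px
... | true  = fz , px , unique , weighted
  where
  rest-false : ∀ j → p (lookup xs j) ≡ false
  rest-false = none xs (ℕₚ.suc-injective ∑≡1)
    where
    none : ∀ ys → ∑ ys (λ a → 𝟙 (p a)) ≡ 0 → ∀ j → p (lookup ys j) ≡ false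
    none (y ∷ ys) ∑≡0 j with p y in py
    none (y ∷ ys) ∑≡0 fz     | false = py
    none (y ∷ ys) ∑≡0 (fs j) | false = none ys ∑≡0 j
  unique : ∀ j′ → p (lookup (x ∷ xs) j′) ≡ true → j′ ≡ fz
  unique fz      _  = refl
  unique (fs j′) pj with () ← trans (sym (rest-false j′)) pj
  weighted-rest : ∀ (h : A → Bool) ys → (∀ j → p (lookup ys j) ≡ false) → ∑ ys (λ a → 𝟙 (p a) ℕ.* 𝟙 (h a)) ≡ 0
  weighted-rest h []       _     = refl
  weighted-rest h (y ∷ ys) p≡false rewrite p≡false fz = weighted-rest h ys (λ j → p≡false (fs j))
  weighted : ∀ h → 𝟙 (h x) ℕ.+ 0 ℕ.+ ∑ xs (λ a → 𝟙 (p a) ℕ.* 𝟙 (h a)) ≡ 𝟙 (h x)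
  weighted h = trans (cong₂ ℕ._+_ (ℕₚ.+-identityʳ (𝟙 (h x))) (weighted-rest h xs rest-false)) (ℕₚ.+-identityʳ (𝟙 (h x)))
... | false with unique-index xs p ∑≡1
...   | j , pj , unique , weighted = fs j , pj , unique′ , weighted
  where
  unique′ : ∀ j′ → p (lookup (x ∷ xs) j′) ≡ true → j′ ≡ fs j
  unique′ fz       p0 with () ← trans (sym px) p0
  unique′ (fs j′) pj′ = cong fs (unique j′ pj′)

∑-weighted-mass : ∀ {n} (L : List (Cell n)) (w : Cell n → ℕ) →
  ∑ L (λ C → w C ℕ.* mass (cellPart C))
  ≡ ∑ (allTriples n) (λ x → 𝟙 (inSupp x) ℕ.* ∑ L (λ C → 𝟙 (inPart (cellPart C) x) ℕ.* w C))
∑-weighted-mass {n} L w = begin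
  ∑ L (λ C → w C ℕ.* mass (cellPart C))
    ≡⟨ ∑-cong L (λ C → cong (w C ℕ.*_) (trans (count≡∑𝟙 _ T) (∑-cong T (λ x → 𝟙-∧ (inSupp x) _)))) ⟩
  ∑ L (λ C → w C ℕ.* ∑ T (λ x → 𝟙 (inSupp x) ℕ.* in′ C x))
    ≡⟨ ∑-cong L (λ C → ∑-*ˡ T (w C) (λ x → 𝟙 (inSupp x) ℕ.* in′ C x)) ⟨
  ∑ L (λ C → ∑ T (λ x → w C ℕ.* (𝟙 (inSupp x) ℕ.* in′ C x)))
    ≡⟨ ∑-swap L T (λ C x → w C ℕ.* (𝟙 (inSupp x) ℕ.* in′ C x)) ⟩
  ∑ T (λ x → ∑ L (λ C → w C ℕ.* (𝟙 (inSupp x) ℕ.* in′ C x)))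
    ≡⟨ ∑-cong T (λ x → trans (∑-cong L (λ C → rearrange (w C) (𝟙 (inSupp x)) (in′ C x)))
                             (∑-*ˡ L (𝟙 (inSupp x)) (λ C → in′ C x ℕ.* w C))) ⟩
  ∑ T (λ x → 𝟙 (inSupp x) ℕ.* ∑ L (λ C → in′ C x ℕ.* w C))
    ∎
  where
  T = allTriples n
  in′ : Cell n → Triple n → ℕ
  in′ C x = 𝟙 (inPart (cellPart C) x)
  rearrange : ∀ w s i → w ℕ.* (s ℕ.* i) ≡ s ℕ.* (i ℕ.* w)
  rearrange = solve-∀

supportSize : ℕ → ℕ
supportSize n = count inSupp (allTriples n)

covers⇒total-mass : ∀ {n} (L : List (Cell n)) → Covers L → ∑ L (λ C → mass (cellPart C)) ≡ supportSize n
covers⇒total-mass {n} L covers = begin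
  ∑ L (λ C → mass (cellPart C))
    ≡⟨ ∑-cong L (λ C → ℕₚ.*-identityˡ (mass (cellPart C))) ⟨
  ∑ L (λ C → 1 ℕ.* mass (cellPart C))
    ≡⟨ ∑-weighted-mass L (λ _ → 1) ⟩
  ∑ (allTriples n) (λ x → 𝟙 (inSupp x) ℕ.* ∑ L (λ C → 𝟙 (inPart (cellPart C) x) ℕ.* 1))
    ≡⟨ ∑-cong (allTriples n) (λ x → cong (𝟙 (inSupp x) ℕ.*_)
         (trans (∑-cong L (λ C → ℕₚ.*-identityʳ _)) (covers x))) ⟩
  ∑ (allTriples n) (λ x → 𝟙 (inSupp x) ℕ.* 1)
    ≡⟨ ∑-cong (allTriples n) (λ x → ℕₚ.*-identityʳ (𝟙 (inSupp x))) ⟩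
  ∑ (allTriples n) (λ x → 𝟙 (inSupp x))
    ≡⟨ count≡∑𝟙 inSupp (allTriples n) ⟨
  supportSize n
    ∎

Codim : ∀ {n} → ℕ → List (Cell n) → Set
Codim {n} d = ListAll.All (λ C → n ∸ dim C ℕ.≤ d)

module _ {n : ℕ} (L : List (Cell n)) (covers : Covers L) where

  private
    located : ∀ x → Σ (Fin (length L)) λ j → inPart (cellPart (lookup L j)) x ≡ true
      × (∀ j′ → inPart (cellPart (lookup L j′)) x ≡ true → j′ ≡ j)
      × (∀ (h : Cell n → Bool) → ∑ L (λ C → 𝟙 (inPart (cellPart C) x) ℕ.* 𝟙 (h C)) ≡ 𝟙 (h (lookup L j)))
    located x = unique-index L (λ C → inPart (cellPart C) x) (covers x)

  cellOf : Triple n → Fin (length L)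
  cellOf x = proj₁ (located x)

  toPartition : ∀ d → Codim d L → AffinePartition n (length L) d
  toPartition d codim = record
    { part     = λ j → cellPart (lookup L j)
    ; codim    = λ j → dim (lookup L j) , (basis (lookup L j) , isBasis (lookup L j))
                     , ListAll.lookup codim (∈-lookup j)
    ; partOf   = cellOf
    ; isPartOf = λ x j → mk⇔ (λ x∈j → sym (proj₁ (proj₂ (proj₂ (located x))) j x∈j))
                             (λ { refl → proj₁ (proj₂ (located x)) })
    }

  count-partOf : ∀ d (codim : Codim d L) (h : Cell n → Bool) →
    count (λ x → inSupp x ∧ h (lookup L (partOf (toPartition d codim) x))) (allTriples n)
    ≡ ∑ L (λ C → 𝟙 (h C) ℕ.* mass (cellPart C))
  count-partOf d codim h = begin
    count (λ x → inSupp x ∧ h (lookup L (cellOf x))) (allTriples n)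
      ≡⟨ count≡∑𝟙 _ (allTriples n) ⟩
    ∑ (allTriples n) (λ x → 𝟙 (inSupp x ∧ h (lookup L (cellOf x))))
      ≡⟨ ∑-cong (allTriples n) (λ x → trans (𝟙-∧ (inSupp x) _)
           (cong (𝟙 (inSupp x) ℕ.*_) (sym (proj₂ (proj₂ (proj₂ (located x))) h)))) ⟩
    ∑ (allTriples n) (λ x → 𝟙 (inSupp x) ℕ.* ∑ L (λ C → 𝟙 (inPart (cellPart C) x) ℕ.* 𝟙 (h C)))
      ≡⟨ ∑-weighted-mass L (λ C → 𝟙 (h C)) ⟨
    ∑ L (λ C → 𝟙 (h C) ℕ.* mass (cellPart C))
      ∎

count-split : ∀ {A : Set} (s g e : A → Bool) xs →
  count (λ x → s x ∧ e x) xs ℕ.≤ count (λ x → s x ∧ (g x ∧ e x)) xs ℕ.+ count (λ x → s x ∧ not (g x)) xs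
count-split s g e xs = subst₂ ℕ._≤_ (sym (count≡∑𝟙 _ xs)) (sym (cong₂ ℕ._+_ (count≡∑𝟙 _ xs) (count≡∑𝟙 _ xs)))
  (ℕₚ.≤-trans (∑-mono xs pointwise) (ℕₚ.≤-reflexive (∑-+ xs _ _)))
  where
  pointwise : ∀ x → 𝟙 (s x ∧ e x) ℕ.≤ 𝟙 (s x ∧ (g x ∧ e x)) ℕ.+ 𝟙 (s x ∧ not (g x))
  pointwise x with s x | g x | e x
  ... | false | _     | _     = ℕ.z≤n
  ... | true  | true  | true  = ℕₚ.≤-refl
  ... | true  | true  | false = ℕ.z≤n
  ... | true  | false | true  = ℕₚ.≤-refl
  ... | true  | false | false = ℕ.z≤n

-- Read Nₛ, CE and CGE as the sizes of supp 𝒫, supp 𝒫 ∩ E and supp 𝒫 ∩ G ∩ E, and Bd as a bound on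
-- the size of supp 𝒫 ∖ G; the conclusion is then 𝒫(G | E) ≥ 1 - δ/α.
conditional-bound : ∀ (Nₛ CE CGE Bd : ℕ) (δ α : ℚ) → ℕ→ℚ CE /? ℕ→ℚ Nₛ ≡ α → 0ℚ < α →
  CE ℕ.≤ CGE ℕ.+ Bd → ℕ→ℚ Bd ≤ δ * ℕ→ℚ Nₛ → 1ℚ - δ /? α ≤ (ℕ→ℚ CGE /? ℕ→ℚ Nₛ) /? α
conditional-bound Nₛ CE CGE Bd δ α CE/N≡α 0<α CE≤ Bd≤ =
  ℚₚ.*-cancelʳ-≤-pos α {{ℚ.positive 0<α}} (subst₂ _≤_ (sym lhs) (sym (/?-*-cancel Y α α≢0))
    (ℚₚ.*-cancelʳ-≤-pos (ℕ→ℚ Nₛ) {{ℚ.positive 0<N}} scaled))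
  where
  α≢0 : α ≢ 0ℚ
  α≢0 α≡0 = ℚₚ.<-irrefl (sym α≡0) 0<α
  N≢0 : ℕ→ℚ Nₛ ≢ 0ℚ
  N≢0 N≡0 = α≢0 (trans (sym CE/N≡α) (/?-zero (ℕ→ℚ CE) (ℕ→ℚ Nₛ) N≡0))
  0<N : 0ℚ < ℕ→ℚ Nₛ
  0<N = nonNeg∧≢0⇒pos (ℕ→ℚ Nₛ) (ℕ→ℚ-nonNeg Nₛ) N≢0
  Y = ℕ→ℚ CGE /? ℕ→ℚ Nₛ
  lhs : (1ℚ - δ /? α) * α ≡ α - δ
  lhs = trans (solve 2 (λ t a → (con 1ℚ :- t) :* a := a :- t :* a) refl (δ /? α) α)
              (cong (λ t → α - t) (/?-*-cancel δ α α≢0))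
  CE≤CGE+δN : ℕ→ℚ CE ≤ ℕ→ℚ CGE + δ * ℕ→ℚ Nₛ
  CE≤CGE+δN = ℚₚ.≤-trans (subst (ℕ→ℚ CE ≤_) (ℕ→ℚ-+ CGE Bd) (ℕ→ℚ-mono-≤ CE≤)) (ℚₚ.+-monoʳ-≤ (ℕ→ℚ CGE) Bd≤)
  scaled : (α - δ) * ℕ→ℚ Nₛ ≤ Y * ℕ→ℚ Nₛ
  scaled = subst₂ _≤_
    (sym (trans (solve 3 (λ a d m → (a :- d) :* m := a :* m :- d :* m) refl α δ (ℕ→ℚ Nₛ))
                (cong (_- δ * ℕ→ℚ Nₛ) (trans (cong (_* ℕ→ℚ Nₛ) (sym CE/N≡α)) (/?-*-cancel (ℕ→ℚ CE) (ℕ→ℚ Nₛ) N≢0)))))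
    (sym (/?-*-cancel (ℕ→ℚ CGE) (ℕ→ℚ Nₛ) N≢0))
    (subst (ℕ→ℚ CE - δ * ℕ→ℚ Nₛ ≤_) (solve 2 (λ b c → b :+ c :- c := b) refl (ℕ→ℚ CGE) (δ * ℕ→ℚ Nₛ))
           (ℚₚ.+-monoˡ-≤ (- (δ * ℕ→ℚ Nₛ)) CE≤CGE+δN))

probP≡α⇒support>0 : ∀ n (A : Triple n → Bool) α → probP n A ≡ α → 0ℚ < α → 0ℚ < ℕ→ℚ (supportSize n)
probP≡α⇒support>0 n A α P≡α 0<α = nonNeg∧≢0⇒pos _ (ℕ→ℚ-nonNeg (supportSize n))
  (λ N≡0 → ℚₚ.<-irrefl (trans (sym (/?-zero _ _ N≡0)) P≡α) 0<α)

-- The refinement algorithm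

refuted : ∀ {P : Set} (d : Dec P) → not (does d) ≡ true → ¬ P
refuted (yes _) ()
refuted (no ¬p) _ = ¬p

module Refinement {n : ℕ} (E : Fin 3 → F2^ n → Bool) (δ : ℚ) (0<δ : 0ℚ < δ) where

  coefficient : (C : Cell n) → Fin 3 → F2^ (dim C) → ℚ
  coefficient C i c = fourierCoeff (space C) (coord i (origin C)) (E i) (character (basis C) c)

  BiasedAt : (C : Cell n) → Fin 3 → F2^ (dim C) → Set
  BiasedAt C i c = nonzero c ≡ true × δ < ∣ coefficient C i c ∣

  Biased : Cell n → Set
  Biased C = ∃ λ i → Any (BiasedAt C i) (allVecs (dim C))

  biased? : ∀ C → Dec (Biased C)
  biased? C = Fin.any? λ i →
    any? (λ c → (nonzero c Bool.≟ true) ×-dec (δ ℚₚ.<? ∣ coefficient C i c ∣)) (allVecs (dim C))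

  good : Cell n → Bool
  good C = not (does (biased? C))

  cellEnergy badMass : Cell n → ℕ
  cellEnergy C = energy E (cellPart C)
  badMass    C = 𝟙 (does (biased? C)) ℕ.* mass (cellPart C)

  split : (C : Cell n) (i : Fin 3) → ∃ (BiasedAt C i) → List (Cell n)
  split (cell a V zero    B isB) i ([] , () , _)
  split (cell a V (suc k) B isB) i (c  , nz , _) = Children.children V B isB c nz a

  step : (C : Cell n) → Dec (Biased C) → List (Cell n)
  step C (yes (i , found)) = split C i (satisfied found)
  step C (no _)            = C ∷ []

  refineAll : List (Cell n) → List (Cell n)
  refineAll = concatMap (λ C → step C (biased? C))

  good⇒uniform : ∀ C → good C ≡ true → Uniform δ E (cellPart C)
  good⇒uniform C@(cell a V k B isB) isGood i χ isχ χ≢0 =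
    ℚₚ.≮⇒≥ (λ δ<coef → unbiased (i , lose (∈-allVecs k c) (nz , biased δ<coef)))
    where
    c = Vec.map χ B
    nz = nonzero-coefficients V B isB χ isχ χ≢0
    biased : δ < ∣ fourierCoeff V (coord i a) (E i) χ ∣ → δ < ∣ coefficient C i c ∣
    biased = subst (λ r → δ < ∣ r ∣)
      (fourierCoeff-cong V (coord i a) (E i) χ (character B c) (isCharacter⇒character V B isB χ isχ))
    unbiased : ¬ Biased C
    unbiased = refuted (biased? C) isGood

  split-covers : ∀ C i w x → ∑ (split C i w) (λ C′ → 𝟙 (inPart (cellPart C′) x)) ≡ 𝟙 (inPart (cellPart C) x)
  split-covers (cell a V zero    B isB) i ([] , () , _) x
  split-covers (cell a V (suc k) B isB) i (c  , nz , _) x = Children.children-cover V B isB c nz a x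

  step-covers : ∀ C d x → ∑ (step C d) (λ C′ → 𝟙 (inPart (cellPart C′) x)) ≡ 𝟙 (inPart (cellPart C) x)
  step-covers C (yes (i , found)) x = split-covers C i (satisfied found) x
  step-covers C (no _)            x = ℕₚ.+-identityʳ _

  split-codim : ∀ C i w t → n ∸ dim C ℕ.≤ t → Codim (suc t) (split C i w)
  split-codim (cell a V zero    B isB) i ([] , () , _) t le
  split-codim (cell a V (suc k) B isB) i (c  , nz , _) t le =
    ListAllₚ.map⁺ {f = Children.child V B isB c nz a}
      (ListAll.universal (λ _ → ℕₚ.≤-trans (codim-suc n k) (ℕ.s≤s le)) signs³)

  step-codim : ∀ C d t → n ∸ dim C ℕ.≤ t → Codim (suc t) (step C d)
  step-codim C (yes (i , found)) t le = split-codim C i (satisfied found) t le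
  step-codim C (no _)            t le = ℕₚ.m≤n⇒m≤1+n le ∷ []

  split-energy : ∀ C i w → ℕ→ℚ (cellEnergy C) + δ * δ * ℕ→ℚ (mass (cellPart C)) ≤ ℕ→ℚ (∑ (split C i w) cellEnergy)
  split-energy (cell a V zero    B isB) i ([] , () , _)
  split-energy (cell a V (suc k) B isB) i (c  , nz , biased) = energy-increment V B isB c nz E a δ 0<δ i biased

  step-energy : ∀ C d → ℕ→ℚ (cellEnergy C) + δ * δ * ℕ→ℚ (𝟙 (does d) ℕ.* mass (cellPart C))
                        ≤ ℕ→ℚ (∑ (step C d) cellEnergy)
  step-energy C (yes (i , found)) =
    subst (λ m → ℕ→ℚ (cellEnergy C) + δ * δ * ℕ→ℚ m ≤ ℕ→ℚ (∑ (split C i (satisfied found)) cellEnergy))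
          (sym (ℕₚ.*-identityˡ (mass (cellPart C))))
          (split-energy C i (satisfied found))
  step-energy C (no _) = ℚₚ.≤-reflexive (begin
    ℕ→ℚ (cellEnergy C) + δ * δ * 0ℚ      ≡⟨ cong (λ t → ℕ→ℚ (cellEnergy C) + t) (ℚₚ.*-zeroʳ (δ * δ)) ⟩
    ℕ→ℚ (cellEnergy C) + 0ℚ              ≡⟨ ℚₚ.+-identityʳ _ ⟩
    ℕ→ℚ (cellEnergy C)                   ≡⟨ cong ℕ→ℚ (ℕₚ.+-identityʳ (cellEnergy C)) ⟨
    ℕ→ℚ (cellEnergy C ℕ.+ 0)             ∎)

  totalEnergy totalBad : List (Cell n) → ℕ
  totalEnergy L = ∑ L cellEnergy
  totalBad    L = ∑ L badMass

  refineAll-covers : ∀ L → Covers L → Covers (refineAll L)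
  refineAll-covers L covers x = begin
    ∑ (refineAll L) in-x                         ≡⟨ ∑-concatMap (λ C → step C (biased? C)) L in-x ⟩
    ∑ L (λ C → ∑ (step C (biased? C)) in-x)      ≡⟨ ∑-cong L (λ C → step-covers C (biased? C) x) ⟩
    ∑ L in-x                                     ≡⟨ covers x ⟩
    1                                            ∎
    where
    in-x : Cell n → ℕ
    in-x C = 𝟙 (inPart (cellPart C) x)

  refineAll-codim : ∀ t L → Codim t L → Codim (suc t) (refineAll L)
  refineAll-codim t []      []          = []
  refineAll-codim t (C ∷ L) (le ∷ les) = ListAllₚ.++⁺ (step-codim C (biased? C) t le) (refineAll-codim t L les)

  refineAll-energy : ∀ L → ℕ→ℚ (totalEnergy L) + δ * δ * ℕ→ℚ (totalBad L) ≤ ℕ→ℚ (totalEnergy (refineAll L))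
  refineAll-energy []      = ℚₚ.≤-reflexive (trans (ℚₚ.+-identityˡ _) (ℚₚ.*-zeroʳ (δ * δ)))
  refineAll-energy (C ∷ L) = subst₂ _≤_ lhs rhs (ℚₚ.+-mono-≤ (step-energy C (biased? C)) (refineAll-energy L))
    where
    e b e′ b′ : ℚ
    e  = ℕ→ℚ (cellEnergy C)
    b  = ℕ→ℚ (badMass C)
    e′ = ℕ→ℚ (totalEnergy L)
    b′ = ℕ→ℚ (totalBad L)
    lhs : (e + δ * δ * b) + (e′ + δ * δ * b′) ≡ ℕ→ℚ (totalEnergy (C ∷ L)) + δ * δ * ℕ→ℚ (totalBad (C ∷ L))
    lhs = trans (solve 5 (λ e b e′ b′ d → (e :+ d :* b) :+ (e′ :+ d :* b′) := (e :+ e′) :+ d :* (b :+ b′))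
                         refl e b e′ b′ (δ * δ))
                (sym (cong₂ (λ x y → x + δ * δ * y) (ℕ→ℚ-+ (cellEnergy C) (totalEnergy L))
                                                     (ℕ→ℚ-+ (badMass C) (totalBad L))))
    rhs : ℕ→ℚ (∑ (step C (biased? C)) cellEnergy) + ℕ→ℚ (totalEnergy (refineAll L))
          ≡ ℕ→ℚ (totalEnergy (refineAll (C ∷ L)))
    rhs = sym (trans (cong ℕ→ℚ (∑-++ (step C (biased? C)) (refineAll L) cellEnergy))
                     (ℕ→ℚ-+ (∑ (step C (biased? C)) cellEnergy) (totalEnergy (refineAll L))))

  totalEnergy≤3N : ∀ L → Covers L → totalEnergy L ℕ.≤ 3 ℕ.* supportSize n
  totalEnergy≤3N L covers = ℕₚ.≤-trans (∑-mono L (λ C → energy≤3*mass E (cellPart C)))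
    (ℕₚ.≤-reflexive (trans (∑-*ˡ L 3 (λ C → mass (cellPart C))) (cong (3 ℕ.*_) (covers⇒total-mass L covers))))

  Nₛ : ℚ
  Nₛ = ℕ→ℚ (supportSize n)

  energy-growth : ∀ L → δ * Nₛ < ℕ→ℚ (totalBad L) →
                  ℕ→ℚ (totalEnergy L) + δ * δ * δ * Nₛ < ℕ→ℚ (totalEnergy (refineAll L))
  energy-growth L bad = ℚₚ.<-≤-trans
    (ℚₚ.+-monoʳ-< (ℕ→ℚ (totalEnergy L))
      (subst (_< δ * δ * ℕ→ℚ (totalBad L)) (sym (ℚₚ.*-assoc (δ * δ) δ Nₛ))
             (ℚₚ.*-monoʳ-<-pos (δ * δ) {{ℚ.positive (*-pos 0<δ 0<δ)}} bad)))
    (refineAll-energy L)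

  Settled : List (Cell n) → Set
  Settled L = ℕ→ℚ (totalBad L) ≤ δ * Nₛ

  settled? : ∀ L → Dec (Settled L)
  settled? L = ℕ→ℚ (totalBad L) ℚₚ.≤? δ * Nₛ

  iterate     : ℕ → List (Cell n) → List (Cell n)
  iterateFrom : ℕ → (L : List (Cell n)) → Dec (Settled L) → List (Cell n)
  iterate zero    L = L
  iterate (suc f) L = iterateFrom f L (settled? L)
  iterateFrom f L (yes _) = L
  iterateFrom f L (no _)  = iterate f (refineAll L)

  iterate-covers     : ∀ f L → Covers L → Covers (iterate f L)
  iterateFrom-covers : ∀ f L d → Covers L → Covers (iterateFrom f L d)
  iterate-covers zero    L covers = covers
  iterate-covers (suc f) L covers = iterateFrom-covers f L (settled? L) covers
  iterateFrom-covers f L (yes _) covers = covers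
  iterateFrom-covers f L (no _)  covers = iterate-covers f (refineAll L) (refineAll-covers L covers)

  iterate-codim     : ∀ f t L → Codim t L → Codim (t ℕ.+ f) (iterate f L)
  iterateFrom-codim : ∀ f t L d → Codim t L → Codim (t ℕ.+ suc f) (iterateFrom f L d)
  iterate-codim zero    t L codim = subst (λ d → Codim d L) (sym (ℕₚ.+-identityʳ t)) codim
  iterate-codim (suc f) t L codim = iterateFrom-codim f t L (settled? L) codim
  iterateFrom-codim f t L (yes _) codim = ListAll.map (λ le → ℕₚ.≤-trans le (ℕₚ.m≤m+n t (suc f))) codim
  iterateFrom-codim f t L (no _)  codim = subst (λ d → Codim d (iterate f (refineAll L))) (sym (ℕₚ.+-suc t f))
                                                (iterate-codim f (suc t) (refineAll L) (refineAll-codim t L codim))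

  Budget : ℕ → List (Cell n) → Set
  Budget f L = ℕ→ℚ (3 ℕ.* supportSize n) < ℕ→ℚ (totalEnergy L) + ℕ→ℚ (suc f) * (δ * δ * δ * Nₛ)

  -- Every unsettled round gains more than δ³ Nₛ of energy, which never exceeds 3 Nₛ.
  iterate-settled     : ∀ f L → Covers L → Budget f L → Settled (iterate f L)
  iterateFrom-settled : ∀ f L d → Covers L → Budget (suc f) L → Settled (iterateFrom f L d)
  iterate-settled zero L covers budget = settle (settled? L)
    where
    one-round : ℕ→ℚ (totalEnergy L) + ℕ→ℚ 1 * (δ * δ * δ * Nₛ) ≡ ℕ→ℚ (totalEnergy L) + δ * δ * δ * Nₛ
    one-round = cong (λ t → ℕ→ℚ (totalEnergy L) + t) (ℚₚ.*-identityˡ (δ * δ * δ * Nₛ))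
    settle : Dec (Settled L) → Settled L
    settle (yes settled)   = settled
    settle (no  unsettled) = ⊥-elim (ℚₚ.<-irrefl refl (ℚₚ.<-≤-trans
      (ℚₚ.<-trans (subst (ℕ→ℚ (3 ℕ.* supportSize n) <_) one-round budget) (energy-growth L (ℚₚ.≰⇒> unsettled)))
      (ℕ→ℚ-mono-≤ (totalEnergy≤3N (refineAll L) (refineAll-covers L covers)))))
  iterate-settled (suc f) L covers budget = iterateFrom-settled f L (settled? L) covers budget
  iterateFrom-settled f L (yes settled)   covers budget = settled
  iterateFrom-settled f L (no  unsettled) covers budget = iterate-settled f (refineAll L) (refineAll-covers L covers)
    (ℚₚ.<-trans (subst (ℕ→ℚ (3 ℕ.* supportSize n) <_) regroup budget)
                (ℚₚ.+-monoˡ-< (ℕ→ℚ (suc f) * (δ * δ * δ * Nₛ)) (energy-growth L (ℚₚ.≰⇒> unsettled))))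
    where
    regroup : ℕ→ℚ (totalEnergy L) + ℕ→ℚ (suc (suc f)) * (δ * δ * δ * Nₛ)
              ≡ ℕ→ℚ (totalEnergy L) + δ * δ * δ * Nₛ + ℕ→ℚ (suc f) * (δ * δ * δ * Nₛ)
    regroup = trans (cong (λ t → ℕ→ℚ (totalEnergy L) + t * (δ * δ * δ * Nₛ)) (ℕ→ℚ-+ 1 (suc f)))
      (solve 3 (λ e c f → e :+ (con 1ℚ :+ f) :* c := e :+ c :+ f :* c) refl
               (ℕ→ℚ (totalEnergy L)) (δ * δ * δ * Nₛ) (ℕ→ℚ (suc f)))

  energy-budget : ∀ K → ℕ→ℚ 3 < ℕ→ℚ (suc K) * (δ * δ * δ) → 0ℚ < Nₛ → ∀ L → Budget K L
  energy-budget K 3<[1+K]δ³ 0<N L = ℚₚ.<-≤-trans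
    (subst₂ _<_ (sym (ℕ→ℚ-* 3 (supportSize n))) (ℚₚ.*-assoc (ℕ→ℚ (suc K)) (δ * δ * δ) Nₛ)
            (ℚₚ.*-monoˡ-<-pos Nₛ {{ℚ.positive 0<N}} 3<[1+K]δ³))
    (subst (_≤ ℕ→ℚ (totalEnergy L) + ℕ→ℚ (suc K) * (δ * δ * δ * Nₛ)) (ℚₚ.+-identityˡ _)
           (ℚₚ.+-monoˡ-≤ (ℕ→ℚ (suc K) * (δ * δ * δ * Nₛ)) (ℕ→ℚ-nonNeg (totalEnergy L))))

  good-conditional : ∀ L (covers : Covers L) d (codim : Codim d L) → Settled L →
    ∀ (A : Triple n → Bool) α → probP n A ≡ α → 0ℚ < α →
    1ℚ - δ /? α ≤ probCond n (λ x → good (lookup L (partOf (toPartition L covers d codim) x))) A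
  good-conditional L covers d codim settled A α P≡α 0<α =
    subst (λ P → 1ℚ - δ /? α ≤ probP n (λ x → G x ∧ A x) /? P) (sym P≡α)
      (conditional-bound (supportSize n) (count (λ x → inSupp x ∧ A x) T) (count (λ x → inSupp x ∧ (G x ∧ A x)) T)
                         (count (λ x → inSupp x ∧ not (G x)) T) δ α P≡α 0<α
                         (count-split inSupp G A T) (subst (λ b → ℕ→ℚ b ≤ δ * Nₛ) (sym bad-count) settled))
    where
    T = allTriples n
    G : Triple n → Bool
    G x = good (lookup L (partOf (toPartition L covers d codim) x))
    bad-count : count (λ x → inSupp x ∧ not (G x)) T ≡ totalBad L
    bad-count = trans (count-partOf L covers d codim (not ∘ good))
                      (∑-cong L (λ C → cong (λ b → 𝟙 b ℕ.* mass (cellPart C)) (not-involutive (does (biased? C)))))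

whole : ∀ n → Subspace n
whole n = record { mem = λ _ → true ; zero∈ = refl ; closed = λ _ _ _ _ → refl }

standardBasis : ∀ n → Vec (F2^ n) n
standardBasis zero    = []
standardBasis (suc n) = (true ∷ 0v) ∷ Vec.map (false ∷_) (standardBasis n)

lincomb-map-false∷ : ∀ {n k} (c : F2^ k) (B : Vec (F2^ n) k) → lincomb c (Vec.map (false ∷_) B) ≡ false ∷ lincomb c B
lincomb-map-false∷ []          []      = refl
lincomb-map-false∷ (true ∷ c)  (b ∷ B) = cong ((false ∷ b) ⊕_) (lincomb-map-false∷ c B)
lincomb-map-false∷ (false ∷ c) (b ∷ B) = lincomb-map-false∷ c B

lincomb-standardBasis : ∀ n (c : F2^ n) → lincomb c (standardBasis n) ≡ c
lincomb-standardBasis zero    []          = refl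
lincomb-standardBasis (suc n) (true ∷ c)
  rewrite lincomb-map-false∷ c (standardBasis n) | lincomb-standardBasis n c = cong (true ∷_) (⊕-identityˡ c)
lincomb-standardBasis (suc n) (false ∷ c)
  rewrite lincomb-map-false∷ c (standardBasis n) | lincomb-standardBasis n c = refl

root : ∀ n → Cell n
root n = cell (0v , 0v , 0v) (whole n) n (standardBasis n)
  ( All.universal (λ _ → refl) (standardBasis n)
  , (λ c eq → trans (sym (lincomb-standardBasis n c)) eq)
  , (λ v _ → v , lincomb-standardBasis n v))

root-covers : ∀ n → Covers (root n ∷ [])
root-covers n x = refl

root-codim : ∀ n → Codim 0 (root n ∷ [])
root-codim n = ℕₚ.≤-reflexive (ℕₚ.n∸n≡0 n) ∷ []

refined-partition : ∀ n (E₁ E₂ E₃ : F2^ n → Bool) α → probP n (prodSet E₁ E₂ E₃) ≡ α → 0ℚ < α →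
  ∀ δ → 0ℚ < δ → ∀ K → ℕ→ℚ 3 < ℕ→ℚ (suc K) * (δ * δ * δ) →
  ∃ λ m → Σ (AffinePartition n m K) λ Π → ∃ λ (G : Fin m → Bool) →
    (∀ j → G j ≡ true → Uniform δ (tri E₁ E₂ E₃) (part Π j)) ×
    (1ℚ - δ /? α ≤ probCond n (λ x → G (partOf Π x)) (prodSet E₁ E₂ E₃))
refined-partition n E₁ E₂ E₃ α P[E]≡α 0<α δ 0<δ K 3<[1+K]δ³ =
  length L , toPartition L covers K codim≤K , (λ j → good (lookup L j)) , uniform , conditional
  where
  open Refinement (tri E₁ E₂ E₃) δ 0<δ
  L₀ L : List (Cell n)
  L₀ = root n ∷ []
  L  = iterate K L₀
  covers : Covers L
  covers = iterate-covers K L₀ (root-covers n)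
  codim≤K : Codim K L
  codim≤K = iterate-codim K 0 L₀ (root-codim n)
  -- Transporting along the (definitional) equation of parts keeps the checker from unfolding Uniform.
  uniform : ∀ j → good (lookup L j) ≡ true → Uniform δ (tri E₁ E₂ E₃) (part (toPartition L covers K codim≤K) j)
  uniform j isGood = subst (Uniform δ (tri E₁ E₂ E₃)) {x = cellPart (lookup L j)} refl (good⇒uniform (lookup L j) isGood)
  conditional : 1ℚ - δ /? α
                ≤ probCond n (λ x → good (lookup L (partOf (toPartition L covers K codim≤K) x))) (prodSet E₁ E₂ E₃)
  conditional = good-conditional L covers K codim≤K
    (iterate-settled K L₀ (root-covers n)
      (energy-budget K 3<[1+K]δ³ (probP≡α⇒support>0 n (prodSet E₁ E₂ E₃) α P[E]≡α 0<α) L₀))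
    (prodSet E₁ E₂ E₃) α P[E]≡α 0<α

proposition3p1 : ∀ (n : ℕ) (E₁ E₂ E₃ : F2^ n → Bool) (α : ℚ) →
    probP n (prodSet E₁ E₂ E₃) ≡ α → 0ℚ < α →
    ∀ (δ : ℚ) → 0ℚ < δ →
    ∃₂ λ (m d : ℕ) →
    (ℕ→ℚ d ≤ ℕ→ℚ 3 /? (δ * δ * δ)) ×
    Σ (AffinePartition n m d) λ Π →
    ∃ λ (G : Fin m → Bool) →
    (∀ j → G j ≡ true → Uniform δ (tri E₁ E₂ E₃) (part Π j)) ×
    (1ℚ - δ /? α ≤ probCond n (λ x → G (partOf Π x)) (prodSet E₁ E₂ E₃))
proposition3p1 n E₁ E₂ E₃ α P[E]≡α 0<α δ 0<δ =
  let K , K≤3/δ³ , 3/δ³<1+K = floor (ℕ→ℚ 3 /? δ³) (/?-nonNeg (ℕ→ℚ 3) δ³ (ℕ→ℚ-nonNeg 3) 0<δ³)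
      m , partition         = refined-partition n E₁ E₂ E₃ α P[E]≡α 0<α δ 0<δ K
                                (/?<⇒<* (ℕ→ℚ 3) δ³ (ℕ→ℚ (suc K)) 0<δ³ 3/δ³<1+K)
  in m , K , K≤3/δ³ , partition
  where
  δ³ = δ * δ * δ
  0<δ³ : 0ℚ < δ³
  0<δ³ = *-pos (*-pos 0<δ 0<δ) 0<δ
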